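{- Let $n$ be a positive integer, and let $\mathcal{M}_0(H_n)$ be the set of perfect matchings $M$ of $H_n$ such that $u_jv_j\notin M$ for all $j=1,2,\ldots,2n$. Then $$\sum_{M\in\mathcal{M}_0(H_n)}x^{af(H_n,M)}=(x^3+3x^2)^n.$$
   Context: For a positive integer $n$, $G_n$ is the plane graph (a polyomino graph with $4n$ unit square faces) with vertex set $\{u_0,v_0\}\cup\{u_i,v_i,w_i,z_i: 1\le i\le 2n\}$, drawn with $w_i$ at $(i,3)$, $u_i$ at $(i,2)$, $v_i$ at $(i,1)$, $z_i$ at $(i,0)$ (and $u_0$ at $(0,2)$, $v_0$ at $(0,1)$), and edge set consisting of: $u_{i-1}u_i$ and $v_{i-1}v_i$ for $1\le i\le 2n$; $u_iv_i$ for $0\le i\le 2n$; $w_iu_i$ and $v_iz_i$ for $1\le i\le 2n$; $w_{2j-1}w_{2j}$ and $z_{2j-1}z_{2j}$ for $1\le j\le n$. $H_n$ is the graph obtained from $G_n$ by deleting the vertices $u_0,v_0$ and their incident edges. For a perfect matching $M$ of a graph $G$, a set $S'\subseteq E(G)\setminus M$ is an anti-forcing set of $M$ if $G-S'$ has a unique perfect matching (namely $M$); the anti-forcing number $af(G,M)$ is the minimum size of an anti-forcing set of $M$. -}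

module Defs where

open import Data.Nat using (ℕ; zero; suc; _⊓_)
open import Data.Bool using (Bool; true; false)
open import Data.Fin using (Fin; zero; suc)
open import Data.Fin.Properties using (all?) renaming (_≟_ to _≟F_)
open import Data.Fin.Subset using (Subset; inside; outside; _∈_; _∉_; _⊆_; _∩_; ∁; ∣_∣)
open import Data.Fin.Subset.Properties using (_∈?_; _⊆?_)
open import Data.List using (List; []; _∷_; _++_; map; filter; length; foldr; concatMap; allFin; lookup)
import Data.Vec as Vec
open import Data.Product using (_×_; _,_; proj₁; proj₂)
open import Data.Product.Properties using (≡-dec)
open import Data.Sum using (_⊎_)
open import Relation.Binary.PropositionalEquality using (_≡_)
open import Relation.Binary.Definitions using (DecidableEquality)
open import Relation.Nullary using (Dec; yes; no; does; ¬_)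
open import Relation.Nullary.Decidable using (_×-dec_; _⊎-dec_; _→-dec_; ¬?; map′)
open import Relation.Unary using (Decidable)
open import Data.Nat.Properties using () renaming (_≟_ to _≟ℕ_)

allSubsets : (m : ℕ) → List (Subset m)
allSubsets zero    = Vec.[] ∷ []
allSubsets (suc m) =
  map (outside Vec.∷_) (allSubsets m) ++ map (inside Vec.∷_) (allSubsets m)

-- Edges are identified by their position in the list; an edge set
-- (spanning subgraph / matching / anti-forcing set) is a Subset of the
-- edge positions.

module GraphTheory {V : Set} (_≟V_ : DecidableEquality V)
                   (∀V? : {P : V → Set} → Decidable P → Dec (∀ v → P v))
                   (edges : List (V × V)) where

  nE : ℕ
  nE = length edges

  Edge : Set
  Edge = Fin nE

  EdgeSet : Set
  EdgeSet = Subset nE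

  ends : Edge → V × V
  ends e = lookup edges e

  Incident : V → Edge → Set
  Incident v e = proj₁ (ends e) ≡ v ⊎ proj₂ (ends e) ≡ v

  incident? : (v : V) (e : Edge) → Dec (Incident v e)
  incident? v e = (proj₁ (ends e) ≟V v) ⊎-dec (proj₂ (ends e) ≟V v)

  star : V → EdgeSet
  star v = Vec.tabulate λ e → does (incident? v e)

  deg : EdgeSet → V → ℕ
  deg M v = ∣ M ∩ star v ∣

  IsPerfectMatching : EdgeSet → EdgeSet → Set
  IsPerfectMatching F M = M ⊆ F × (∀ v → deg M v ≡ 1)

  isPerfectMatching? : (F : EdgeSet) → Decidable (IsPerfectMatching F)
  isPerfectMatching? F M = (M ⊆? F) ×-dec ∀V? (λ v → deg M v ≟ℕ 1)

  perfectMatchings : EdgeSet → List EdgeSet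
  perfectMatchings F = filter (isPerfectMatching? F) (allSubsets nE)

  allEdges : EdgeSet
  allEdges = Vec.replicate nE inside

  IsAntiForcingSet : EdgeSet → EdgeSet → Set
  IsAntiForcingSet M S = S ⊆ ∁ M × length (perfectMatchings (∁ S)) ≡ 1

  isAntiForcingSet? : (M : EdgeSet) → Decidable (IsAntiForcingSet M)
  isAntiForcingSet? M S = (S ⊆? ∁ M) ×-dec (length (perfectMatchings (∁ S)) ≟ℕ 1)

  -- The fold starts
  -- from ∣ ∁ M ∣, the size of E(G) \ M, which is itself an anti-forcing
  -- set whenever M is a perfect matching, so this is exactly the minimum.
  af : EdgeSet → ℕ
  af M = foldr _⊓_ ∣ ∁ M ∣ (map ∣_∣ (filter (isAntiForcingSet? M) (allSubsets nE)))

-- Vertex (j , s , r): j : Fin n is the block, s : Fin 2 the position in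
-- the block, so the paper's column index is i = 2j + s + 1 (1 ≤ i ≤ 2n);
-- r is the row/height: 0 = z, 1 = v, 2 = u, 3 = w.

VH : ℕ → Set
VH n = Fin n × Fin 2 × Fin 4

_≟VH_ : {n : ℕ} → DecidableEquality (VH n)
_≟VH_ = ≡-dec _≟F_ (≡-dec _≟F_ _≟F_)

∀VH? : {n : ℕ} {P : VH n → Set} → Decidable P → Dec (∀ v → P v)
∀VH? P? = map′ (λ h v → h (proj₁ v) (proj₁ (proj₂ v)) (proj₂ (proj₂ v)))
               (λ h a b c → h (a , b , c))
               (all? λ a → all? λ b → all? λ c → P? (a , b , c))

zV vV uV wV : {n : ℕ} → Fin n → Fin 2 → VH n
zV j s = j , s , zero
vV j s = j , s , suc zero
uV j s = j , s , suc (suc zero)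
wV j s = j , s , suc (suc (suc zero))

succPairs : (n : ℕ) → List (Fin n × Fin n)
succPairs zero = []
succPairs (suc zero) = []
succPairs (suc (suc n)) =
  (zero , suc zero) ∷ map (λ p → suc (proj₁ p) , suc (proj₂ p)) (succPairs (suc n))

s0 s1 : Fin 2
s0 = zero
s1 = suc zero

edgesH : (n : ℕ) → List (VH n × VH n)
edgesH n =
  concatMap (λ j → concatMap (λ s →
      (uV j s , vV j s) ∷ (wV j s , uV j s) ∷ (vV j s , zV j s) ∷ [])
    (allFin 2)) (allFin n)
  -- u_{i-1} u_i , v_{i-1} v_i with i = 2j (inside a block) ...
  ++ concatMap (λ j →
      (uV j s0 , uV j s1) ∷ (vV j s0 , vV j s1) ∷
      -- ... and w_{2j-1} w_{2j} , z_{2j-1} z_{2j}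
      (wV j s0 , wV j s1) ∷ (zV j s0 , zV j s1) ∷ []) (allFin n)
  -- u_{i-1} u_i , v_{i-1} v_i with i = 2j+1 (between blocks), 2 ≤ i ≤ 2n
  ++ concatMap (λ p →
      (uV (proj₁ p) s1 , uV (proj₂ p) s0) ∷ (vV (proj₁ p) s1 , vV (proj₂ p) s0) ∷ [])
    (succPairs n)

module H (n : ℕ) = GraphTheory (_≟VH_ {n}) (∀VH? {n}) (edgesH n)

Is𝓜₀ : (n : ℕ) → H.EdgeSet n → Set
Is𝓜₀ n M = H.IsPerfectMatching n (H.allEdges n) M
         × (∀ (e : H.Edge n) (j : Fin n) (s : Fin 2) →
              H.ends n e ≡ (uV j s , vV j s) → e ∉ M)

is𝓜₀? : (n : ℕ) → Decidable (Is𝓜₀ n)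
is𝓜₀? n M = H.isPerfectMatching? n (H.allEdges n) M
  ×-dec all? (λ e → all? λ j → all? λ s →
           (≡-dec _≟VH_ _≟VH_ (H.ends n e) (uV j s , vV j s)) →-dec ¬? (e ∈? M))

𝓜₀ : (n : ℕ) → List (H.EdgeSet n)
𝓜₀ n = filter (is𝓜₀? n) (allSubsets (H.nE n))

{-# OPTIONS --safe #-}
module Submission where

-- H_n is a row of n blocks of eight vertices (columns 2j+1, 2j+2), consecutive blocks being
-- joined only by the two bridge edges u_{2j}u_{2j+1} and v_{2j}v_{2j+1}. A perfect matching
-- avoiding every u_iv_i uses no bridge: inductively from the left, a block whose left bridges
-- are unused must also leave its right bridges unused. So it is a union of local perfect
-- matchings of the blocks, each of four types A, B, C, D, and 𝓜₀(H_n) is in bijection with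
-- {A,B,C,D}^n. Inside a block of type A there are three alternating cycles and inside the other
-- types two; switching one block along one of them gives another perfect matching, so an
-- anti-forcing set contains, for every block and every such cycle, an edge that the switched
-- matching adds, and these edges are all distinct. Conversely three (type A) or two edges per
-- block form an anti-forcing set. Hence af(H_n,M) = 3·#A + 2·(#B + #C + #D), and summing over
-- {A,B,C,D}^n gives (x^3 + 3x^2)^n. Statements about a single block are finite and decided by
-- computation.

open import Defs
open import Data.Bool using (Bool; true; false; if_then_else_) renaming (_≟_ to _≟ᴮ_)
open import Data.Bool.Properties using (¬-not)
open import Data.Empty using (⊥-elim)
open import Data.Fin using (Fin; zero; suc; toℕ; inject₁)
open import Data.Fin.Properties using (all?; any?; toℕ-injective; toℕ-inject₁) renaming (_≟_ to _≟F_)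
open import Data.Fin.Subset using (Subset; inside; outside; _∈_; _∉_; _⊆_; _∩_; ∁; ∣_∣; _-_; ⁅_⁆; Nonempty)
open import Data.Fin.Subset.Properties
  using ( x∈p∧x≢y⇒x∈p-y; x∈p⇒∣p-x∣<∣p∣; x∈⁅x⁆; x∈⁅y⁆⇒x≡y; ∣⁅x⁆∣≡1; ⊆-antisym; nonempty?; Empty-unique; ∣⊥∣≡0
        ; x∈p∩q⁺; x∈p∩q⁻; p⊆q⇒∣p∣≤∣q∣; _∈?_; x∈∁p⇒x∉p; x∉p⇒x∈∁p )
open import Data.List
  using (List; []; _∷_; length; filter; map; _++_; foldr; concatMap; allFin; fromMaybe; cartesianProductWith)
  renaming (lookup to llookup; tabulate to tabulateˡ)
open import Data.List.Properties using (map-++; map-∘; map-cong; length-map; length-++; map-tabulate)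
open import Data.List.Membership.Propositional using (find; lose) renaming (_∈_ to _∈ˡ_)
open import Data.List.Membership.Propositional.Properties
  using ( ∈-filter⁺; ∈-filter⁻; ∈-++⁺ˡ; ∈-++⁺ʳ; ∈-++⁻; ∈-map⁺; ∈-map⁻; ∈-concatMap⁺; ∈-concatMap⁻; ∈-lookup; ∈-allFin
        ; ∈-cartesianProductWith⁺ )
open import Data.List.Membership.Propositional.Properties.WithK using (unique∧set⇒bag)
open import Data.List.Membership.DecPropositional (_≟F_ {10}) using () renaming (_∈?_ to _∈¹⁰?_)
open import Data.List.Membership.DecPropositional (_≟F_ {5}) using () renaming (_∈?_ to _∈⁵?_)
open import Data.List.Relation.Binary.BagAndSetEquality using (∼bag⇒↭)
open import Data.List.Relation.Binary.Permutation.Propositional.Properties using () renaming (map⁺ to ↭-map⁺)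
open import Data.List.Relation.Unary.All using ([]; _∷_) renaming (lookup to lookupᴬ; tabulate to tabulateᴬ)
open import Data.List.Relation.Unary.AllPairs using ([]; _∷_)
open import Data.List.Relation.Unary.Any using (here; there; index)
open import Data.List.Relation.Unary.Any.Properties using (lookup-index)
open import Data.List.Relation.Unary.Unique.Propositional using (Unique)
open import Data.List.Relation.Unary.Unique.Propositional.Properties using (filter⁺; ++⁺; map⁺; allFin⁺; cartesianProductWith⁺)
open import Data.List.Relation.Unary.Unique.DecPropositional (_≟F_ {10}) using () renaming (unique? to unique¹⁰?)
open import Data.List.Relation.Unary.Unique.DecPropositional (_≟F_ {5}) using () renaming (unique? to unique⁵?)
open import Data.Maybe as Maybe using (Maybe; just; nothing; maybe′)
open import Data.Nat using (ℕ; zero; suc; _+_; _*_; _^_; _≤_; _<_; z≤n; s≤s; _⊓_)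
open import Data.Nat.ListAction using (sum)
open import Data.Nat.ListAction.Properties using (sum-↭; sum-++)
open import Data.Nat.Properties
  using ( ≤-trans; ≤-reflexive; ≤-antisym; m≤n⇒m≤1+n; m⊓n≤m; m⊓n≤n; ⊓-glb; n<1⇒n≡0; n≮0; suc-injective; 1+n≢n
        ; *-zeroʳ; *-distribˡ-+; ^-distribˡ-+-* )
  renaming (_≟_ to _≟ℕ_)
open import Data.Nat.Solver using (module +-*-Solver)
open import Data.Product using (∃; _×_; _,_; proj₁; proj₂)
open import Data.Product.Properties using (≡-dec)
open import Data.Sum using (_⊎_; inj₁; inj₂)
open import Data.Vec using (Vec; []; _∷_; tabulate) renaming (here to vhere; there to vthere; lookup to vlookup)
open import Data.Vec.Properties
  using (∷-injective; ∷-injectiveʳ; tabulate-cong; tabulate∘lookup; []=⇒lookup; lookup⇒[]=; lookup∘tabulate; lookup-replicate)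
  renaming (≡-dec to ≡-decᵛ)
open import Function using (_∘_; id; case_of_)
open import Function.Bundles using (mk⇔)
open import Relation.Binary.Definitions using (DecidableEquality)
open import Relation.Binary.PropositionalEquality
  using (_≡_; _≢_; refl; sym; trans; cong; cong₂; subst; module ≡-Reasoning)
open import Relation.Nullary using (Dec; yes; no; ¬_; does; contradiction)
open import Relation.Nullary.Decidable using (dec-true; dec-false; ¬?; _×-dec_; _⊎-dec_; _→-dec_; map′; toWitness)
open import Relation.Unary using (Pred; Decidable)

∀x∉p⇒∣p∣≡0 : ∀ {m} {p : Subset m} → (∀ {x} → x ∉ p) → ∣ p ∣ ≡ 0
∀x∉p⇒∣p∣≡0 {m} x∉p = trans (cong ∣_∣ (Empty-unique (λ (_ , x∈p) → x∉p x∈p))) (∣⊥∣≡0 m)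

∣p∣≡0⇒x∉p : ∀ {m} {p : Subset m} → ∣ p ∣ ≡ 0 → ∀ {x} → x ∉ p
∣p∣≡0⇒x∉p {p = p} ∣p∣≡0 x∈p = n≮0 (subst (∣ p - _ ∣ <_) ∣p∣≡0 (x∈p⇒∣p-x∣<∣p∣ x∈p))

∣p∣≡1⇒nonempty : ∀ {m} {p : Subset m} → ∣ p ∣ ≡ 1 → Nonempty p
∣p∣≡1⇒nonempty {p = p} ∣p∣≡1 with nonempty? p
... | yes ne = ne
... | no ¬ne with () ← trans (sym ∣p∣≡1) (∀x∉p⇒∣p∣≡0 (λ x∈p → ¬ne (_ , x∈p)))

∣p∣≡1⇒∈-unique : ∀ {m} {p : Subset m} → ∣ p ∣ ≡ 1 → ∀ {x y} → x ∈ p → y ∈ p → x ≡ y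
∣p∣≡1⇒∈-unique {p = p} ∣p∣≡1 {x} {y} x∈p y∈p with x ≟F y
... | yes x≡y = x≡y
... | no x≢y = contradiction (x∈p∧x≢y⇒x∈p-y y∈p (x≢y ∘ sym))
                 (∣p∣≡0⇒x∉p {p = p - x} (n<1⇒n≡0 (subst (∣ p - x ∣ <_) ∣p∣≡1 (x∈p⇒∣p-x∣<∣p∣ x∈p))))

∈-unique⇒∣p∣≡1 : ∀ {m} {p : Subset m} {x} → x ∈ p → (∀ {y} → y ∈ p → y ≡ x) → ∣ p ∣ ≡ 1
∈-unique⇒∣p∣≡1 {p = p} {x} x∈p unique = trans (cong ∣_∣ p≡⁅x⁆) (∣⁅x⁆∣≡1 x)
  where
  p≡⁅x⁆ : p ≡ ⁅ x ⁆
  p≡⁅x⁆ = ⊆-antisym (λ y∈p → subst (_∈ ⁅ x ⁆) (sym (unique y∈p)) (x∈⁅x⁆ x))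
                    (λ y∈⁅x⁆ → subst (_∈ p) (sym (x∈⁅y⁆⇒x≡y x y∈⁅x⁆)) x∈p)

Unique⇒length≤∣p∣ : ∀ {m} {p : Subset m} (xs : List (Fin m)) → Unique xs → (∀ {x} → x ∈ˡ xs → x ∈ p) →
                    length xs ≤ ∣ p ∣
Unique⇒length≤∣p∣ []       _            _    = z≤n
Unique⇒length≤∣p∣ {p = p} (x ∷ xs) (x∉xs ∷ uxs) xs⊆p =
  ≤-trans (s≤s (Unique⇒length≤∣p∣ xs uxs xs⊆p-x)) (x∈p⇒∣p-x∣<∣p∣ (xs⊆p (here refl)))
  where
  xs⊆p-x : ∀ {y} → y ∈ˡ xs → y ∈ p - x
  xs⊆p-x y∈xs = x∈p∧x≢y⇒x∈p-y (xs⊆p (there y∈xs)) (λ y≡x → lookupᴬ x∉xs y∈xs (sym y≡x))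

dropZero : ∀ {m} → List (Fin (suc m)) → List (Fin m)
dropZero []          = []
dropZero (zero  ∷ xs) = dropZero xs
dropZero (suc x ∷ xs) = x ∷ dropZero xs

length-dropZero : ∀ {m} (xs : List (Fin (suc m))) → length (dropZero xs) ≤ length xs
length-dropZero []          = z≤n
length-dropZero (zero  ∷ xs) = m≤n⇒m≤1+n (length-dropZero xs)
length-dropZero (suc x ∷ xs) = s≤s (length-dropZero xs)

length-dropZero-< : ∀ {m} (xs : List (Fin (suc m))) → zero ∈ˡ xs → length (dropZero xs) < length xs
length-dropZero-< (zero  ∷ xs) _          = s≤s (length-dropZero xs)
length-dropZero-< (suc x ∷ xs) (there z∈xs) = s≤s (length-dropZero-< xs z∈xs)

∈-dropZero⁺ : ∀ {m} (xs : List (Fin (suc m))) {x} → suc x ∈ˡ xs → x ∈ˡ dropZero xs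
∈-dropZero⁺ (zero  ∷ xs) (there sx∈xs)  = ∈-dropZero⁺ xs sx∈xs
∈-dropZero⁺ (suc y ∷ xs) (here refl)    = here refl
∈-dropZero⁺ (suc y ∷ xs) (there sx∈xs)  = there (∈-dropZero⁺ xs sx∈xs)

∣p∣≤length : ∀ {m} (p : Subset m) (xs : List (Fin m)) → (∀ {x} → x ∈ p → x ∈ˡ xs) → ∣ p ∣ ≤ length xs
∣p∣≤length []            xs p⊆xs = z≤n
∣p∣≤length (outside ∷ p) xs p⊆xs =
  ≤-trans (∣p∣≤length p (dropZero xs) (∈-dropZero⁺ xs ∘ p⊆xs ∘ vthere)) (length-dropZero xs)
∣p∣≤length (inside  ∷ p) xs p⊆xs =
  ≤-trans (s≤s (∣p∣≤length p (dropZero xs) (∈-dropZero⁺ xs ∘ p⊆xs ∘ vthere))) (length-dropZero-< xs (p⊆xs vhere))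

module _ {A : Set} where

  Unique⇒lookup-injective : ∀ (xs : List A) → Unique xs → ∀ i j → llookup xs i ≡ llookup xs j → i ≡ j
  Unique⇒lookup-injective (x ∷ xs) u         zero    zero    eq = refl
  Unique⇒lookup-injective (x ∷ xs) (x∉ ∷ u) zero    (suc j) eq = ⊥-elim (lookupᴬ x∉ (∈-lookup j) eq)
  Unique⇒lookup-injective (x ∷ xs) (x∉ ∷ u) (suc i) zero    eq = ⊥-elim (lookupᴬ x∉ (∈-lookup i) (sym eq))
  Unique⇒lookup-injective (x ∷ xs) (x∉ ∷ u) (suc i) (suc j) eq = cong suc (Unique⇒lookup-injective xs u i j eq)

  length≡1⇒nonempty : ∀ (xs : List A) → length xs ≡ 1 → ∃ λ x → x ∈ˡ xs
  length≡1⇒nonempty (x ∷ []) _ = x , here refl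

  length≡1⇒∈-unique : ∀ (xs : List A) → length xs ≡ 1 → ∀ {x y} → x ∈ˡ xs → y ∈ˡ xs → x ≡ y
  length≡1⇒∈-unique (z ∷ []) _ (here refl) (here refl) = refl

  ∈-unique⇒length≡1 : ∀ (xs : List A) → Unique xs → ∀ {x} → x ∈ˡ xs → (∀ {y} → y ∈ˡ xs → y ≡ x) →
                      length xs ≡ 1
  ∈-unique⇒length≡1 (y ∷ [])     _                _ _      = refl
  ∈-unique⇒length≡1 (y ∷ z ∷ xs) ((y≢z ∷ _) ∷ _) _ unique =
    ⊥-elim (y≢z (trans (unique (here refl)) (sym (unique (there (here refl))))))

  module _ {ℓ} {P : Pred A ℓ} (P? : Decidable P) where

    length-filter≡1 : ∀ (xs : List A) → Unique xs → ∀ {x} → x ∈ˡ xs → P x →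
                      (∀ {y} → y ∈ˡ xs → P y → y ≡ x) → length (filter P? xs) ≡ 1
    length-filter≡1 xs uxs x∈xs px unique =
      ∈-unique⇒length≡1 (filter P? xs) (filter⁺ P? uxs) (∈-filter⁺ P? x∈xs px)
        (λ y∈ → let (y∈xs , py) = ∈-filter⁻ P? y∈ in unique y∈xs py)

    length-filter≡1⇒unique : ∀ (xs : List A) → length (filter P? xs) ≡ 1 →
                             ∀ {x y} → x ∈ˡ xs → y ∈ˡ xs → P x → P y → x ≡ y
    length-filter≡1⇒unique xs len≡1 x∈xs y∈xs px py =
      length≡1⇒∈-unique (filter P? xs) len≡1 (∈-filter⁺ P? x∈xs px) (∈-filter⁺ P? y∈xs py)

  concatMap-unique : ∀ {B : Set} (f : A → List B) (key : B → A) (xs : List A) → Unique xs →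
                     (∀ x → Unique (f x)) → (∀ x {b} → b ∈ˡ f x → key b ≡ x) → Unique (concatMap f xs)
  concatMap-unique f key []       _          _  _     = []
  concatMap-unique f key (x ∷ xs) (x∉ ∷ uxs) uf keyed = ++⁺ (uf x) (concatMap-unique f key xs uxs uf keyed) disjoint
    where
    disjoint : ∀ {b} → ¬ (b ∈ˡ f x × b ∈ˡ concatMap f xs)
    disjoint (b∈fx , b∈rest) with find (∈-concatMap⁻ f {xs = xs} b∈rest)
    ... | y , y∈xs , b∈fy = lookupᴬ x∉ y∈xs (trans (sym (keyed x b∈fx)) (keyed y b∈fy))

  map-unique-injectiveOn : ∀ {B : Set} (f : A → B) (xs : List A) → Unique xs →
                           (∀ {x y} → x ∈ˡ xs → y ∈ˡ xs → f x ≡ f y → x ≡ y) → Unique (map f xs)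
  map-unique-injectiveOn f []       _          _   = []
  map-unique-injectiveOn f (x ∷ xs) (x∉ ∷ uxs) inj =
    tabulateᴬ fx≢ ∷ map-unique-injectiveOn f xs uxs (λ x∈ y∈ → inj (there x∈) (there y∈))
    where
    fx≢ : ∀ {z} → z ∈ˡ map f xs → f x ≢ z
    fx≢ z∈ with ∈-map⁻ f z∈
    ... | y , y∈xs , refl = λ fx≡fy → lookupᴬ x∉ y∈xs (inj (here refl) (there y∈xs) fx≡fy)

  sum-map-sameMembers : ∀ (f : A → ℕ) {xs ys : List A} → Unique xs → Unique ys →
                        (∀ {x} → x ∈ˡ xs → x ∈ˡ ys) → (∀ {x} → x ∈ˡ ys → x ∈ˡ xs) →
                        sum (map f xs) ≡ sum (map f ys)
  sum-map-sameMembers f uxs uys xs⊆ys ys⊆xs =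
    sum-↭ (↭-map⁺ f (∼bag⇒↭ (unique∧set⇒bag uxs uys (mk⇔ xs⊆ys ys⊆xs))))

length-concatMap : ∀ {A B : Set} (f : A → List B) xs → length (concatMap f xs) ≡ sum (map (length ∘ f) xs)
length-concatMap f []       = refl
length-concatMap f (x ∷ xs) = trans (length-++ (f x)) (cong (length (f x) +_) (length-concatMap f xs))

sum-cartesianProductWith : ∀ {A B C : Set} (h : C → ℕ) (f : A → B → C) xs ys →
  sum (map h (cartesianProductWith f xs ys)) ≡ sum (map (λ x → sum (map (h ∘ f x) ys)) xs)
sum-cartesianProductWith h f []       ys = refl
sum-cartesianProductWith h f (x ∷ xs) ys = begin
  sum (map h (map (f x) ys ++ cartesianProductWith f xs ys))
    ≡⟨ cong sum (map-++ h (map (f x) ys) _) ⟩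
  sum (map h (map (f x) ys) ++ map h (cartesianProductWith f xs ys))
    ≡⟨ sum-++ (map h (map (f x) ys)) _ ⟩
  sum (map h (map (f x) ys)) + sum (map h (cartesianProductWith f xs ys))
    ≡⟨ cong₂ _+_ (cong sum (sym (map-∘ ys))) (sum-cartesianProductWith h f xs ys) ⟩
  sum (map (h ∘ f x) ys) + sum (map (λ x → sum (map (h ∘ f x) ys)) xs) ∎
  where open ≡-Reasoning

sum-map-*ˡ : ∀ {A : Set} k (g : A → ℕ) xs → sum (map (λ a → k * g a) xs) ≡ k * sum (map g xs)
sum-map-*ˡ k g []       = sym (*-zeroʳ k)
sum-map-*ˡ k g (x ∷ xs) = trans (cong (k * g x +_) (sum-map-*ˡ k g xs)) (sym (*-distribˡ-+ k (g x) _))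

foldr-⊓-≤ : ∀ (init : ℕ) (xs : List ℕ) {x} → x ∈ˡ xs → foldr _⊓_ init xs ≤ x
foldr-⊓-≤ init (x ∷ xs) (here refl) = m⊓n≤m x _
foldr-⊓-≤ init (x ∷ xs) (there y∈xs) = ≤-trans (m⊓n≤n x _) (foldr-⊓-≤ init xs y∈xs)

foldr-⊓-glb : ∀ {k} (init : ℕ) (xs : List ℕ) → k ≤ init → (∀ {x} → x ∈ˡ xs → k ≤ x) → k ≤ foldr _⊓_ init xs
foldr-⊓-glb init []       k≤init _   = k≤init
foldr-⊓-glb init (x ∷ xs) k≤init k≤xs = ⊓-glb (k≤xs (here refl)) (foldr-⊓-glb init xs k≤init (k≤xs ∘ there))

fromMaybe-unique : ∀ {A : Set} (m : Maybe A) → Unique (fromMaybe m)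
fromMaybe-unique nothing  = []
fromMaybe-unique (just _) = [] ∷ []

∈-fromMaybe-map⁻ : ∀ {A B : Set} (f : A → B) (m : Maybe A) {b} → b ∈ˡ fromMaybe (Maybe.map f m) →
                   ∃ λ a → m ≡ just a × b ≡ f a
∈-fromMaybe-map⁻ f (just a) (here refl) = a , refl , refl

∈-tabulate⁻ : ∀ {m} (f : Fin m → Bool) {x} → x ∈ tabulate f → f x ≡ true
∈-tabulate⁻ f {x} x∈ = trans (sym (lookup∘tabulate f x)) ([]=⇒lookup x∈)

∈-tabulate⁺ : ∀ {m} (f : Fin m → Bool) {x} → f x ≡ true → x ∈ tabulate f
∈-tabulate⁺ f {x} fx = lookup⇒[]= x _ (trans (lookup∘tabulate f x) fx)

Vec-ext : ∀ {A : Set} {m} {u v : Vec A m} → (∀ i → vlookup u i ≡ vlookup v i) → u ≡ v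
Vec-ext {u = u} {v} u≗v = trans (sym (tabulate∘lookup u)) (trans (tabulate-cong u≗v) (tabulate∘lookup v))

does≡true⇒ : ∀ {a} {A : Set a} (a? : Dec A) → does a? ≡ true → A
does≡true⇒ (yes a) _ = a

witnessOr : ∀ {A : Set} {P : A → Set} → A → Dec (∃ P) → A
witnessOr _ (yes (a , _)) = a
witnessOr a (no _)        = a

witnessOr-sound : ∀ {A : Set} {P : A → Set} a (p? : Dec (∃ P)) → ¬ ¬ ∃ P → P (witnessOr a p?)
witnessOr-sound a (yes (_ , pa)) _   = pa
witnessOr-sound a (no ¬p)        ¬¬p = contradiction ¬p ¬¬p

true≢false : true ≢ false
true≢false ()

Bool-≡ : ∀ {x} b → (b ≡ true → x ≡ true) → (b ≡ false → x ≡ false) → x ≡ b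
Bool-≡ true  x≡true  _       = x≡true refl
Bool-≡ false _       x≡false = x≡false refl

countTrue : List Bool → ℕ
countTrue []           = 0
countTrue (true  ∷ bs) = suc (countTrue bs)
countTrue (false ∷ bs) = countTrue bs

countTrue-++ : ∀ as bs → countTrue (as ++ bs) ≡ countTrue as + countTrue bs
countTrue-++ []           bs = refl
countTrue-++ (true  ∷ as) bs = cong suc (countTrue-++ as bs)
countTrue-++ (false ∷ as) bs = countTrue-++ as bs

countTrue-does : ∀ {A : Set} {P : A → Set} (P? : Decidable P) xs → countTrue (map (does ∘ P?) xs) ≡ length (filter P? xs)
countTrue-does P? []       = refl
countTrue-does P? (x ∷ xs) with P? x
... | yes _ = cong suc (countTrue-does P? xs)
... | no  _ = countTrue-does P? xs

countTrue-fromMaybe : ∀ {A B : Set} (g : B → Bool) (f : A → B) m →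
                      countTrue (map g (fromMaybe (Maybe.map f m))) ≡ countTrue (maybe′ (g ∘ f) false m ∷ [])
countTrue-fromMaybe g f nothing  = refl
countTrue-fromMaybe g f (just _) = refl

∀Bool? : ∀ {P : Bool → Set} → Decidable P → Dec (∀ b → P b)
∀Bool? P? = map′ (λ (pt , pf) → λ { true → pt ; false → pf }) (λ h → h true , h false) (P? true ×-dec P? false)

∀Bool²? : ∀ {P : Bool × Bool → Set} → Decidable P → Dec (∀ b → P b)
∀Bool²? P? = map′ (λ h x → h (proj₁ x) (proj₂ x)) (λ h a b → h (a , b)) (∀Bool? λ a → ∀Bool? λ b → P? (a , b))

∀Vec? : ∀ k {P : Vec Bool k → Set} → Decidable P → Dec (∀ v → P v)
∀Vec? zero    P? = map′ (λ p → λ { [] → p }) (λ h → h []) (P? [])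
∀Vec? (suc k) P? = map′ (λ h → λ { (b ∷ v) → h b v }) (λ h b v → h (b ∷ v)) (∀Bool? λ b → ∀Vec? k λ v → P? (b ∷ v))

-- Perfect matchings and anti-forcing sets

allSubsets-complete : ∀ m (p : Subset m) → p ∈ˡ allSubsets m
allSubsets-complete zero    []            = here refl
allSubsets-complete (suc m) (outside ∷ p) = ∈-++⁺ˡ (∈-map⁺ (outside ∷_) (allSubsets-complete m p))
allSubsets-complete (suc m) (inside  ∷ p) =
  ∈-++⁺ʳ (map (outside ∷_) (allSubsets m)) (∈-map⁺ (inside ∷_) (allSubsets-complete m p))

allSubsets-unique : ∀ m → Unique (allSubsets m)
allSubsets-unique zero    = [] ∷ []
allSubsets-unique (suc m) =
  ++⁺ (map⁺ ∷-injectiveʳ (allSubsets-unique m)) (map⁺ ∷-injectiveʳ (allSubsets-unique m)) disjoint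
  where
  disjoint : ∀ {p} → ¬ (p ∈ˡ map (outside ∷_) (allSubsets m) × p ∈ˡ map (inside ∷_) (allSubsets m))
  disjoint (p∈out , p∈in) with ∈-map⁻ (outside ∷_) p∈out | ∈-map⁻ (inside ∷_) p∈in
  ... | _ , _ , refl | _ , _ , ()

module GraphTheoryProperties {V : Set} (_≟V_ : DecidableEquality V)
                             (∀V? : {P : V → Set} → Decidable P → Dec (∀ v → P v))
                             (edges : List (V × V)) where
  open GraphTheory _≟V_ ∀V? edges

  ∈star⁻ : ∀ {v e} → e ∈ star v → Incident v e
  ∈star⁻ {v} e∈ = does≡true⇒ (incident? v _) (∈-tabulate⁻ (λ e → does (incident? v e)) e∈)

  ∈star⁺ : ∀ {v e} → Incident v e → e ∈ star v
  ∈star⁺ {v} {e} inc = ∈-tabulate⁺ (λ e → does (incident? v e)) (dec-true (incident? v e) inc)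

  ∈allEdges : ∀ e → e ∈ allEdges
  ∈allEdges e = lookup⇒[]= e allEdges (lookup-replicate e inside)

  CoveredOnceBy : EdgeSet → V → Set
  CoveredOnceBy M v = (∃ λ e → e ∈ M × Incident v e) ×
                      (∀ {e e'} → e ∈ M → Incident v e → e' ∈ M → Incident v e' → e ≡ e')

  isPerfectMatching⁻ : ∀ {F M} → IsPerfectMatching F M → ∀ v → CoveredOnceBy M v
  isPerfectMatching⁻ {M = M} (_ , deg≡1) v =
    (let (e , e∈) = ∣p∣≡1⇒nonempty (deg≡1 v) ; (e∈M , e∈star) = x∈p∩q⁻ M (star v) e∈
     in e , e∈M , ∈star⁻ e∈star) ,
    λ e∈M inc e'∈M inc' → ∣p∣≡1⇒∈-unique (deg≡1 v) (x∈p∩q⁺ (e∈M , ∈star⁺ inc)) (x∈p∩q⁺ (e'∈M , ∈star⁺ inc'))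

  isPerfectMatching⁺ : ∀ {F M} → M ⊆ F → (∀ v → CoveredOnceBy M v) → IsPerfectMatching F M
  isPerfectMatching⁺ {M = M} M⊆F covered = M⊆F , λ v →
    let ((e , e∈M , inc) , unique) = covered v in
    ∈-unique⇒∣p∣≡1 (x∈p∩q⁺ (e∈M , ∈star⁺ inc))
      (λ e'∈ → let (e'∈M , e'∈star) = x∈p∩q⁻ M (star v) e'∈ in unique e'∈M (∈star⁻ e'∈star) e∈M inc)

  unique-perfectMatching : ∀ F M → IsPerfectMatching F M → (∀ N → IsPerfectMatching F N → N ≡ M) →
                           length (perfectMatchings F) ≡ 1
  unique-perfectMatching F M pm unique =
    length-filter≡1 (isPerfectMatching? F) (allSubsets nE) (allSubsets-unique nE) (allSubsets-complete nE M) pm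
      (λ {N} _ → unique N)

  perfectMatching-unique : ∀ F {M N} → length (perfectMatchings F) ≡ 1 →
                           IsPerfectMatching F M → IsPerfectMatching F N → M ≡ N
  perfectMatching-unique F {M} {N} len≡1 =
    length-filter≡1⇒unique (isPerfectMatching? F) (allSubsets nE) len≡1 (allSubsets-complete nE M) (allSubsets-complete nE N)

  af≡ : ∀ M k S → IsAntiForcingSet M S → ∣ S ∣ ≤ k → (∀ S' → IsAntiForcingSet M S' → k ≤ ∣ S' ∣) → af M ≡ k
  af≡ M k S afS ∣S∣≤k minimal = ≤-antisym af≤k k≤af
    where
    antiForcingSizes = map ∣_∣ (filter (isAntiForcingSet? M) (allSubsets nE))
    af≤k : af M ≤ k
    af≤k = ≤-trans (foldr-⊓-≤ ∣ ∁ M ∣ antiForcingSizes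
             (∈-map⁺ ∣_∣ (∈-filter⁺ (isAntiForcingSet? M) (allSubsets-complete nE S) afS))) ∣S∣≤k
    k≤af : k ≤ af M
    k≤af = foldr-⊓-glb ∣ ∁ M ∣ antiForcingSizes (≤-trans (minimal S afS) (p⊆q⇒∣p∣≤∣q∣ (proj₁ afS))) λ k∈ →
      let (S' , S'∈ , k≡) = ∈-map⁻ ∣_∣ k∈ in
      subst (k ≤_) (sym k≡) (minimal S' (proj₂ (∈-filter⁻ (isAntiForcingSet? M) {xs = allSubsets nE} S'∈)))

-- The block structure of H_n

Site : Set
Site = Fin 2 × Fin 4

rz rv ru rw : Fin 4
rz = zero
rv = suc zero
ru = suc (suc zero)
rw = suc (suc (suc zero))

localEdges : Vec (Site × Site) 10
localEdges =
  ((s0 , ru) , (s0 , rv)) ∷ ((s0 , rw) , (s0 , ru)) ∷ ((s0 , rv) , (s0 , rz)) ∷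
  ((s1 , ru) , (s1 , rv)) ∷ ((s1 , rw) , (s1 , ru)) ∷ ((s1 , rv) , (s1 , rz)) ∷
  ((s0 , ru) , (s1 , ru)) ∷ ((s0 , rv) , (s1 , rv)) ∷ ((s0 , rw) , (s1 , rw)) ∷ ((s0 , rz) , (s1 , rz)) ∷ []

localEdge : Fin 10 → Site × Site
localEdge i = vlookup localEdges i

inBlock : ∀ {n} → Fin n → Site × Site → VH n × VH n
inBlock j (a , b) = (j , a) , (j , b)

crossU crossV : ∀ {n} → Fin n → Fin n → VH n × VH n
crossU j k = uV j s1 , uV k s0
crossV j k = vV j s1 , vV k s0

IsNext : ∀ {n} → Fin n → Fin n → Set
IsNext j k = toℕ k ≡ suc (toℕ j)

∈-succPairs⁻ : ∀ n {j k : Fin n} → (j , k) ∈ˡ succPairs n → IsNext j k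
∈-succPairs⁻ (suc (suc n)) (here refl) = refl
∈-succPairs⁻ (suc (suc n)) (there jk∈) with ∈-map⁻ _ jk∈
... | _ , jk∈′ , refl = cong suc (∈-succPairs⁻ (suc n) jk∈′)

∈-succPairs⁺ : ∀ n {j k : Fin n} → IsNext j k → (j , k) ∈ˡ succPairs n
∈-succPairs⁺ (suc (suc n)) {zero}  {suc zero} _    = here refl
∈-succPairs⁺ (suc (suc n)) {suc j} {suc k}    next =
  there (∈-map⁺ (λ p → suc (proj₁ p) , suc (proj₂ p)) (∈-succPairs⁺ (suc n) (suc-injective next)))

succPairs-unique : ∀ n → Unique (succPairs n)
succPairs-unique zero          = []
succPairs-unique (suc zero)    = []
succPairs-unique (suc (suc n)) = tabulateᴬ head≢ ∷ map⁺ sucPair-injective (succPairs-unique (suc n))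
  where
  sucPair-injective : ∀ {x y : Fin (suc n) × Fin (suc n)} →
                      (suc (proj₁ x) , suc (proj₂ x)) ≡ (suc (proj₁ y) , suc (proj₂ y)) → x ≡ y
  sucPair-injective refl = refl
  head≢ : ∀ {p} → p ∈ˡ map (λ p → suc (proj₁ p) , suc (proj₂ p)) (succPairs (suc n)) → (zero , suc zero) ≢ p
  head≢ p∈ with ∈-map⁻ _ p∈
  ... | _ , _ , refl = λ ()

columnEdges : ∀ {n} → Fin n → Fin 2 → List (VH n × VH n)
columnEdges j s = (uV j s , vV j s) ∷ (wV j s , uV j s) ∷ (vV j s , zV j s) ∷ []

blockColumnEdges : ∀ {n} → Fin n → List (VH n × VH n)
blockColumnEdges j = concatMap (columnEdges j) (allFin 2)

blockRowEdges : ∀ {n} → Fin n → List (VH n × VH n)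
blockRowEdges j = (uV j s0 , uV j s1) ∷ (vV j s0 , vV j s1) ∷ (wV j s0 , wV j s1) ∷ (zV j s0 , zV j s1) ∷ []

bridgeEdges : ∀ {n} → Fin n × Fin n → List (VH n × VH n)
bridgeEdges (j , k) = crossU j k ∷ crossV j k ∷ []

allColumnEdges allBlockRowEdges allBridgeEdges : ∀ n → List (VH n × VH n)
allColumnEdges   n = concatMap blockColumnEdges (allFin n)
allBlockRowEdges n = concatMap blockRowEdges (allFin n)
allBridgeEdges   n = concatMap bridgeEdges (succPairs n)

∈columnEdges⇒∈edgesH : ∀ {n} (j : Fin n) (s : Fin 2) {p} → p ∈ˡ columnEdges j s → p ∈ˡ edgesH n
∈columnEdges⇒∈edgesH j s p∈ =
  ∈-++⁺ˡ (∈-concatMap⁺ blockColumnEdges (lose (∈-allFin j) (∈-concatMap⁺ (columnEdges j) (lose (∈-allFin s) p∈))))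

∈blockRowEdges⇒∈edgesH : ∀ {n} (j : Fin n) {p} → p ∈ˡ blockRowEdges j → p ∈ˡ edgesH n
∈blockRowEdges⇒∈edgesH {n} j p∈ =
  ∈-++⁺ʳ (allColumnEdges n) (∈-++⁺ˡ (∈-concatMap⁺ blockRowEdges (lose (∈-allFin j) p∈)))

inBlock∈edgesH : ∀ {n} (j : Fin n) i → inBlock j (localEdge i) ∈ˡ edgesH n
inBlock∈edgesH j zero = ∈columnEdges⇒∈edgesH j s0 (here refl)
inBlock∈edgesH j (suc zero) = ∈columnEdges⇒∈edgesH j s0 (there (here refl))
inBlock∈edgesH j (suc (suc zero)) = ∈columnEdges⇒∈edgesH j s0 (there (there (here refl)))
inBlock∈edgesH j (suc (suc (suc zero))) = ∈columnEdges⇒∈edgesH j s1 (here refl)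
inBlock∈edgesH j (suc (suc (suc (suc zero)))) = ∈columnEdges⇒∈edgesH j s1 (there (here refl))
inBlock∈edgesH j (suc (suc (suc (suc (suc zero))))) = ∈columnEdges⇒∈edgesH j s1 (there (there (here refl)))
inBlock∈edgesH j (suc (suc (suc (suc (suc (suc zero)))))) = ∈blockRowEdges⇒∈edgesH j (here refl)
inBlock∈edgesH j (suc (suc (suc (suc (suc (suc (suc zero))))))) = ∈blockRowEdges⇒∈edgesH j (there (here refl))
inBlock∈edgesH j (suc (suc (suc (suc (suc (suc (suc (suc zero)))))))) = ∈blockRowEdges⇒∈edgesH j (there (there (here refl)))
inBlock∈edgesH j (suc (suc (suc (suc (suc (suc (suc (suc (suc zero))))))))) = ∈blockRowEdges⇒∈edgesH j (there (there (there (here refl))))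

IsBlockEdge IsBridgeEdge : ∀ {n} → VH n × VH n → Set
IsBlockEdge  {n} p = ∃ λ (j : Fin n) → ∃ λ i → p ≡ inBlock j (localEdge i)
IsBridgeEdge {n} p = ∃ λ (j : Fin n) → ∃ λ k → IsNext j k × (p ≡ crossU j k ⊎ p ≡ crossV j k)

edgesH-classify : ∀ {n} {p : VH n × VH n} → p ∈ˡ edgesH n → IsBlockEdge p ⊎ IsBridgeEdge p
edgesH-classify {n} p∈ with ∈-++⁻ (allColumnEdges n) p∈
... | inj₁ p∈₁ with find (∈-concatMap⁻ blockColumnEdges {xs = allFin n} p∈₁)
...   | j , _ , p∈₂ with find (∈-concatMap⁻ (columnEdges j) {xs = allFin 2} p∈₂)
...     | zero , _ , here refl = inj₁ (j , zero , refl)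
...     | zero , _ , there (here refl) = inj₁ (j , suc zero , refl)
...     | zero , _ , there (there (here refl)) = inj₁ (j , suc (suc zero) , refl)
...     | suc zero , _ , here refl = inj₁ (j , suc (suc (suc zero)) , refl)
...     | suc zero , _ , there (here refl) = inj₁ (j , suc (suc (suc (suc zero))) , refl)
...     | suc zero , _ , there (there (here refl)) = inj₁ (j , suc (suc (suc (suc (suc zero)))) , refl)
edgesH-classify {n} p∈ | inj₂ p∈₁ with ∈-++⁻ (allBlockRowEdges n) p∈₁
... | inj₁ p∈₂ with find (∈-concatMap⁻ blockRowEdges {xs = allFin n} p∈₂)
...   | j , _ , here refl = inj₁ (j , suc (suc (suc (suc (suc (suc zero))))) , refl)
...   | j , _ , there (here refl) = inj₁ (j , suc (suc (suc (suc (suc (suc (suc zero)))))) , refl)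
...   | j , _ , there (there (here refl)) = inj₁ (j , suc (suc (suc (suc (suc (suc (suc (suc zero))))))) , refl)
...   | j , _ , there (there (there (here refl))) = inj₁ (j , suc (suc (suc (suc (suc (suc (suc (suc (suc zero)))))))) , refl)
edgesH-classify {n} p∈ | inj₂ p∈₁ | inj₂ p∈₂ with find (∈-concatMap⁻ bridgeEdges {xs = succPairs n} p∈₂)
... | (j , k) , jk∈ , here refl = inj₂ (j , k , ∈-succPairs⁻ n jk∈ , inj₁ refl)
... | (j , k) , jk∈ , there (here refl) = inj₂ (j , k , ∈-succPairs⁻ n jk∈ , inj₂ refl)

blockOf : ∀ {n} → VH n × VH n → Fin n
blockOf p = proj₁ (proj₁ p)

columns : ∀ {n} → VH n × VH n → Fin 2 × Fin 2
columns p = proj₁ (proj₂ (proj₁ p)) , proj₁ (proj₂ (proj₂ p))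

columnEdges-key : ∀ {n} (j : Fin n) s {p} → p ∈ˡ columnEdges j s → blockOf p ≡ j × columns p ≡ (s , s)
columnEdges-key j s (here refl)                 = refl , refl
columnEdges-key j s (there (here refl))         = refl , refl
columnEdges-key j s (there (there (here refl))) = refl , refl

blockRowEdges-key : ∀ {n} (j : Fin n) {p} → p ∈ˡ blockRowEdges j → blockOf p ≡ j × columns p ≡ (s0 , s1)
blockRowEdges-key j (here refl)                         = refl , refl
blockRowEdges-key j (there (here refl))                 = refl , refl
blockRowEdges-key j (there (there (here refl)))         = refl , refl
blockRowEdges-key j (there (there (there (here refl)))) = refl , refl

bridgeEdges-key : ∀ {n} (jk : Fin n × Fin n) {p} → p ∈ˡ bridgeEdges jk →
                  (blockOf p , proj₁ (proj₂ p)) ≡ jk × columns p ≡ (s1 , s0)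
bridgeEdges-key jk (here refl)         = refl , refl
bridgeEdges-key jk (there (here refl)) = refl , refl

blockColumnEdges-key : ∀ {n} (j : Fin n) {p} → p ∈ˡ blockColumnEdges j → blockOf p ≡ j × ∃ λ s → columns p ≡ (s , s)
blockColumnEdges-key j p∈ with find (∈-concatMap⁻ (columnEdges j) {xs = allFin 2} p∈)
... | s , _ , p∈′ = proj₁ (columnEdges-key j s p∈′) , s , proj₂ (columnEdges-key j s p∈′)

edgesH-unique : ∀ n → Unique (edgesH n)
edgesH-unique n = ++⁺ unique₁ (++⁺ unique₂ unique₃ disjoint₂₃) disjoint₁
  where
  unique₁ = concatMap-unique blockColumnEdges blockOf (allFin n) (allFin⁺ n)
              (λ j → concatMap-unique (columnEdges j) (proj₁ ∘ columns) (allFin 2) (allFin⁺ 2)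
                       (λ _ → ((λ ()) ∷ (λ ()) ∷ []) ∷ ((λ ()) ∷ []) ∷ [] ∷ [])
                       (λ s p∈ → cong proj₁ (proj₂ (columnEdges-key j s p∈))))
              (λ j p∈ → proj₁ (blockColumnEdges-key j p∈))
  unique₂ = concatMap-unique blockRowEdges blockOf (allFin n) (allFin⁺ n)
              (λ _ → ((λ ()) ∷ (λ ()) ∷ (λ ()) ∷ []) ∷ ((λ ()) ∷ (λ ()) ∷ []) ∷ ((λ ()) ∷ []) ∷ [] ∷ [])
              (λ j p∈ → proj₁ (blockRowEdges-key j p∈))
  unique₃ = concatMap-unique bridgeEdges (λ p → blockOf p , proj₁ (proj₂ p)) (succPairs n) (succPairs-unique n)
              (λ _ → ((λ ()) ∷ []) ∷ [] ∷ [])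
              (λ jk p∈ → proj₁ (bridgeEdges-key jk p∈))
  columnsᴮ : ∀ {p} → p ∈ˡ allBlockRowEdges n → columns p ≡ (s0 , s1)
  columnsᴮ p∈ with find (∈-concatMap⁻ blockRowEdges {xs = allFin n} p∈)
  ... | j , _ , p∈′ = proj₂ (blockRowEdges-key j p∈′)
  columnsᴿ : ∀ {p} → p ∈ˡ allBridgeEdges n → columns p ≡ (s1 , s0)
  columnsᴿ p∈ with find (∈-concatMap⁻ bridgeEdges {xs = succPairs n} p∈)
  ... | jk , _ , p∈′ = proj₂ (bridgeEdges-key jk p∈′)
  columnsᶜ : ∀ {p} → p ∈ˡ allColumnEdges n → ∃ λ s → columns p ≡ (s , s)
  columnsᶜ p∈ with find (∈-concatMap⁻ blockColumnEdges {xs = allFin n} p∈)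
  ... | j , _ , p∈′ = proj₂ (blockColumnEdges-key j p∈′)
  disjoint₂₃ : ∀ {p} → ¬ (p ∈ˡ allBlockRowEdges n × p ∈ˡ allBridgeEdges n)
  disjoint₂₃ (p∈₂ , p∈₃) with trans (sym (columnsᴮ p∈₂)) (columnsᴿ p∈₃)
  ... | ()
  disjoint₁ : ∀ {p} → ¬ (p ∈ˡ allColumnEdges n × p ∈ˡ allBlockRowEdges n ++ allBridgeEdges n)
  disjoint₁ (p∈₁ , p∈₂₃) with columnsᶜ p∈₁ | ∈-++⁻ (allBlockRowEdges n) p∈₂₃
  ... | s , cols≡ | inj₁ p∈₂ with trans (sym cols≡) (columnsᴮ p∈₂)
  ...   | ()
  disjoint₁ (p∈₁ , p∈₂₃) | s , cols≡ | inj₂ p∈₃ with trans (sym cols≡) (columnsᴿ p∈₃)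
  ...   | ()

nextBlock : ∀ {n} → Fin n → Maybe (Fin n)
nextBlock {suc zero}    zero    = nothing
nextBlock {suc (suc n)} zero    = just (suc zero)
nextBlock {suc (suc n)} (suc j) = Maybe.map suc (nextBlock j)

prevBlock : ∀ {n} → Fin n → Maybe (Fin n)
prevBlock zero    = nothing
prevBlock (suc j) = just (inject₁ j)

IsNext⇒nextBlock : ∀ {n} {j k : Fin n} → IsNext j k → nextBlock j ≡ just k
IsNext⇒nextBlock {suc (suc n)} {zero}  {suc zero} _    = refl
IsNext⇒nextBlock {suc (suc n)} {suc j} {suc k}    next rewrite IsNext⇒nextBlock {j = j} {k} (suc-injective next) = refl

nextBlock⇒IsNext : ∀ {n} {j k : Fin n} → nextBlock j ≡ just k → IsNext j k
nextBlock⇒IsNext {suc (suc n)} {zero}  refl = refl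
nextBlock⇒IsNext {suc (suc n)} {suc j} eq with nextBlock j in next≡
nextBlock⇒IsNext {suc (suc n)} {suc j} refl | just _ = cong suc (nextBlock⇒IsNext next≡)

IsNext⇒prevBlock : ∀ {n} {j k : Fin n} → IsNext k j → prevBlock j ≡ just k
IsNext⇒prevBlock {j = suc j} next = cong just (toℕ-injective (trans (toℕ-inject₁ j) (suc-injective next)))

prevBlock⇒IsNext : ∀ {n} {j k : Fin n} → prevBlock j ≡ just k → IsNext k j
prevBlock⇒IsNext {j = suc j} refl = cong suc (sym (toℕ-inject₁ j))

IsNext⇒≢ : ∀ {n} {j k : Fin n} → IsNext j k → j ≢ k
IsNext⇒≢ next refl = 1+n≢n (sym next)

-- A single block

pattern u₀v₀ = zero
pattern w₀u₀ = suc zero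
pattern v₀z₀ = suc (suc zero)
pattern u₁v₁ = suc (suc (suc zero))
pattern w₁u₁ = suc (suc (suc (suc zero)))
pattern v₁z₁ = suc (suc (suc (suc (suc zero))))
pattern u₀u₁ = suc (suc (suc (suc (suc (suc zero)))))
pattern v₀v₁ = suc (suc (suc (suc (suc (suc (suc zero))))))
pattern w₀w₁ = suc (suc (suc (suc (suc (suc (suc (suc zero)))))))
pattern z₀z₁ = suc (suc (suc (suc (suc (suc (suc (suc (suc zero))))))))

_≟ˢ_ : DecidableEquality Site
_≟ˢ_ = ≡-dec _≟F_ _≟F_

∀Site? : ∀ {P : Site → Set} → Decidable P → Dec (∀ x → P x)
∀Site? P? = map′ (λ h x → h (proj₁ x) (proj₂ x)) (λ h s r → h (s , r)) (all? λ s → all? λ r → P? (s , r))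

localStar : Site → List (Fin 10)
localStar (zero     , zero)                   = v₀z₀ ∷ z₀z₁ ∷ []
localStar (zero     , suc zero)               = u₀v₀ ∷ v₀z₀ ∷ v₀v₁ ∷ []
localStar (zero     , suc (suc zero))         = u₀v₀ ∷ w₀u₀ ∷ u₀u₁ ∷ []
localStar (zero     , suc (suc (suc zero)))   = w₀u₀ ∷ w₀w₁ ∷ []
localStar (suc zero , zero)                   = v₁z₁ ∷ z₀z₁ ∷ []
localStar (suc zero , suc zero)               = u₁v₁ ∷ v₁z₁ ∷ v₀v₁ ∷ []
localStar (suc zero , suc (suc zero))         = u₁v₁ ∷ w₁u₁ ∷ u₀u₁ ∷ []
localStar (suc zero , suc (suc (suc zero)))   = w₁u₁ ∷ w₀w₁ ∷ []

LocallyIncident : Site → Fin 10 → Set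
LocallyIncident x i = proj₁ (localEdge i) ≡ x ⊎ proj₂ (localEdge i) ≡ x

localStar-complete : ∀ i x → LocallyIncident x i → i ∈ˡ localStar x
localStar-complete = toWitness {a? = all? λ i → ∀Site? λ x →
  ((proj₁ (localEdge i) ≟ˢ x) ⊎-dec (proj₂ (localEdge i) ≟ˢ x)) →-dec (i ∈¹⁰? localStar x)} _

localStar-sound : ∀ x i → i ∈ˡ localStar x → LocallyIncident x i
localStar-sound = toWitness {a? = ∀Site? λ x → all? λ i →
  (i ∈¹⁰? localStar x) →-dec ((proj₁ (localEdge i) ≟ˢ x) ⊎-dec (proj₂ (localEdge i) ≟ˢ x))} _

localStar-unique : ∀ x → Unique (localStar x)
localStar-unique = toWitness {a? = ∀Site? λ x → unique¹⁰? (localStar x)} _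

localEdge-injective : ∀ i i' → localEdge i ≡ localEdge i' → i ≡ i'
localEdge-injective = toWitness {a? = all? λ i → all? λ i' → (≡-dec _≟ˢ_ _≟ˢ_ (localEdge i) (localEdge i')) →-dec (i ≟F i')} _

-- The four flags record whether the bridge edges at u₁, v₁ (to the right) and at u₀, v₀
-- (to the left) of a block are used.
bridgeFlags : Site → Bool → Bool → Bool → Bool → List Bool
bridgeFlags (zero     , suc zero)       rU rV lU lV = lV ∷ []
bridgeFlags (zero     , suc (suc zero)) rU rV lU lV = lU ∷ []
bridgeFlags (suc zero , suc zero)       rU rV lU lV = rV ∷ []
bridgeFlags (suc zero , suc (suc zero)) rU rV lU lV = rU ∷ []
bridgeFlags _                           rU rV lU lV = []

LocallyPerfect : Vec Bool 10 → Bool → Bool → Bool → Bool → Set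
LocallyPerfect β rU rV lU lV =
  ∀ x → countTrue (map (vlookup β) (localStar x) ++ bridgeFlags x rU rV lU lV) ≡ 1

locallyPerfect? : ∀ β rU rV lU lV → Dec (LocallyPerfect β rU rV lU lV)
locallyPerfect? β rU rV lU lV = ∀Site? λ x → countTrue (map (vlookup β) (localStar x) ++ bridgeFlags x rU rV lU lV) ≟ℕ 1

LocallyPerfect-cong : ∀ {β β' rU rU' rV rV' lU lU' lV lV'} → β ≡ β' → rU ≡ rU' → rV ≡ rV' → lU ≡ lU' → lV ≡ lV' →
                      LocallyPerfect β rU rV lU lV → LocallyPerfect β' rU' rV' lU' lV'
LocallyPerfect-cong refl refl refl refl refl perfect = perfect

LocallyPerfect-leftFree : ∀ {β rU rV lU lV} → lU ≡ false → lV ≡ false → LocallyPerfect β rU rV lU lV → LocallyPerfect β rU rV false false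
LocallyPerfect-leftFree refl refl perfect = perfect

Avoids : Vec Bool 10 → Vec Bool 10 → Set
Avoids β σ = ∀ i → vlookup σ i ≡ true → vlookup β i ≡ false

avoids? : ∀ β σ → Dec (Avoids β σ)
avoids? β σ = all? λ i → (vlookup σ i ≟ᴮ true) →-dec (vlookup β i ≟ᴮ false)

-- The perfect matchings of a single block: typeA..typeD avoid u₀v₀ and u₁v₁ and are indexed
-- by (w₀w₁ ∈ M , z₀z₁ ∈ M); typeE is the remaining one.
BlockType : Set
BlockType = Fin 5

pattern typeA = zero
pattern typeB = suc zero
pattern typeC = suc (suc zero)
pattern typeD = suc (suc (suc zero))
pattern typeE = suc (suc (suc (suc zero)))

blockType : Bool × Bool → BlockType
blockType (true  , true)  = typeA
blockType (false , true)  = typeB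
blockType (true  , false) = typeC
blockType (false , false) = typeD

blockMatchingEdges : BlockType → List (Fin 10)
blockMatchingEdges typeA = u₀u₁ ∷ v₀v₁ ∷ w₀w₁ ∷ z₀z₁ ∷ []
blockMatchingEdges typeB = w₀u₀ ∷ w₁u₁ ∷ v₀v₁ ∷ z₀z₁ ∷ []
blockMatchingEdges typeC = w₀w₁ ∷ u₀u₁ ∷ v₀z₀ ∷ v₁z₁ ∷ []
blockMatchingEdges typeD = w₀u₀ ∷ w₁u₁ ∷ v₀z₀ ∷ v₁z₁ ∷ []
blockMatchingEdges typeE = w₀w₁ ∷ u₀v₀ ∷ u₁v₁ ∷ z₀z₁ ∷ []

blockAntiForcingEdges : BlockType → List (Fin 10)
blockAntiForcingEdges typeA = w₀u₀ ∷ v₀z₀ ∷ u₀v₀ ∷ []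
blockAntiForcingEdges typeB = w₀w₁ ∷ v₀z₀ ∷ []
blockAntiForcingEdges typeC = z₀z₁ ∷ w₀u₀ ∷ []
blockAntiForcingEdges typeD = w₀w₁ ∷ z₀z₁ ∷ []
blockAntiForcingEdges typeE = []

-- The block types reached from a given one along a single alternating cycle inside the block.
alternatives : BlockType → List BlockType
alternatives typeA = typeB ∷ typeC ∷ typeE ∷ []
alternatives typeB = typeA ∷ typeD ∷ []
alternatives typeC = typeA ∷ typeD ∷ []
alternatives typeD = typeB ∷ typeC ∷ []
alternatives typeE = []

indicator : List (Fin 10) → Vec Bool 10
indicator is = tabulate (λ i → does (i ∈¹⁰? is))

∈-indicator⁻ : ∀ is {i} → vlookup (indicator is) i ≡ true → i ∈ˡ is
∈-indicator⁻ is {i} σi = does≡true⇒ (i ∈¹⁰? is) (trans (sym (lookup∘tabulate (λ i → does (i ∈¹⁰? is)) i)) σi)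

blockMatching blockAntiForcing : BlockType → Vec Bool 10
blockMatching    t = indicator (blockMatchingEdges t)
blockAntiForcing t = indicator (blockAntiForcingEdges t)

locallyPerfect-without-uv⇒blockMatching :
  ∀ β rU rV → LocallyPerfect β rU rV false false → vlookup β u₀v₀ ≡ false → vlookup β u₁v₁ ≡ false →
  rU ≡ false × rV ≡ false × β ≡ blockMatching (blockType (vlookup β w₀w₁ , vlookup β z₀z₁))
locallyPerfect-without-uv⇒blockMatching = toWitness {a? = ∀Vec? 10 λ β → ∀Bool? λ rU → ∀Bool? λ rV →
  locallyPerfect? β rU rV false false →-dec ((vlookup β u₀v₀ ≟ᴮ false) →-dec ((vlookup β u₁v₁ ≟ᴮ false) →-dec
  ((rU ≟ᴮ false) ×-dec ((rV ≟ᴮ false) ×-dec ≡-decᵛ _≟ᴮ_ β (blockMatching (blockType (vlookup β w₀w₁ , vlookup β z₀z₁)))))))} _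

locallyPerfect-avoiding⇒blockMatching :
  ∀ c β rU rV → LocallyPerfect β rU rV false false → Avoids β (blockAntiForcing (blockType c)) →
  rU ≡ false × rV ≡ false × β ≡ blockMatching (blockType c)
locallyPerfect-avoiding⇒blockMatching = toWitness {a? = ∀Bool²? λ c → ∀Vec? 10 λ β → ∀Bool? λ rU → ∀Bool? λ rV →
  locallyPerfect? β rU rV false false →-dec (avoids? β (blockAntiForcing (blockType c)) →-dec
  ((rU ≟ᴮ false) ×-dec ((rV ≟ᴮ false) ×-dec ≡-decᵛ _≟ᴮ_ β (blockMatching (blockType c)))))} _

blockMatching-locallyPerfect : ∀ t → LocallyPerfect (blockMatching t) false false false false
blockMatching-locallyPerfect = toWitness {a? = all? λ t → locallyPerfect? (blockMatching t) false false false false} _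

blockMatching-avoids-uv : ∀ c (s : Fin 2) i → localEdge i ≡ ((s , ru) , (s , rv)) →
                          vlookup (blockMatching (blockType c)) i ≡ false
blockMatching-avoids-uv = toWitness {a? = ∀Bool²? λ c → all? λ s → all? λ i →
  (≡-dec _≟ˢ_ _≟ˢ_ (localEdge i) ((s , ru) , (s , rv))) →-dec (vlookup (blockMatching (blockType c)) i ≟ᴮ false)} _

blockAntiForcing-avoids-blockMatching : ∀ c → Avoids (blockMatching (blockType c)) (blockAntiForcing (blockType c))
blockAntiForcing-avoids-blockMatching = toWitness {a? = ∀Bool²? λ c → avoids? (blockMatching (blockType c)) (blockAntiForcing (blockType c))} _

length-blockAntiForcingEdges : ∀ c → length (blockAntiForcingEdges (blockType c)) ≡ length (alternatives (blockType c))
length-blockAntiForcingEdges (true  , true)  = refl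
length-blockAntiForcingEdges (false , true)  = refl
length-blockAntiForcingEdges (true  , false) = refl
length-blockAntiForcingEdges (false , false) = refl

alternative-hasNewEdge : ∀ c t → t ∈ˡ alternatives (blockType c) →
  ∃ λ i → vlookup (blockMatching t) i ≡ true × vlookup (blockMatching (blockType c)) i ≡ false
alternative-hasNewEdge = toWitness {a? = ∀Bool²? λ c → all? λ t → (t ∈⁵? alternatives (blockType c)) →-dec
  any? λ i → (vlookup (blockMatching t) i ≟ᴮ true) ×-dec (vlookup (blockMatching (blockType c)) i ≟ᴮ false)} _

alternatives-newEdge-injective : ∀ c t t' i → t ∈ˡ alternatives (blockType c) → t' ∈ˡ alternatives (blockType c) →
  vlookup (blockMatching t) i ≡ true → vlookup (blockMatching t') i ≡ true →
  vlookup (blockMatching (blockType c)) i ≡ false → t ≡ t'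
alternatives-newEdge-injective = toWitness {a? = ∀Bool²? λ c → all? λ t → all? λ t' → all? λ i →
  (t ∈⁵? alternatives (blockType c)) →-dec ((t' ∈⁵? alternatives (blockType c)) →-dec
  ((vlookup (blockMatching t) i ≟ᴮ true) →-dec ((vlookup (blockMatching t') i ≟ᴮ true) →-dec
  ((vlookup (blockMatching (blockType c)) i ≟ᴮ false) →-dec (t ≟F t')))))} _

alternatives-unique : ∀ c → Unique (alternatives (blockType c))
alternatives-unique = toWitness {a? = ∀Bool²? λ c → unique⁵? (alternatives (blockType c))} _

blockMatching∘blockType-injective : ∀ c c' → blockMatching (blockType c) ≡ blockMatching (blockType c') → c ≡ c'
blockMatching∘blockType-injective = toWitness {a? = ∀Bool²? λ c → ∀Bool²? λ c' →
  ≡-decᵛ _≟ᴮ_ (blockMatching (blockType c)) (blockMatching (blockType c')) →-dec ≡-dec _≟ᴮ_ _≟ᴮ_ c c'} _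

-- Configurations of blocks and their weights

blockWeight : Bool × Bool → ℕ
blockWeight b = length (alternatives (blockType b))

weight : ∀ {m} → Vec (Bool × Bool) m → ℕ
weight []      = 0
weight (b ∷ c) = blockWeight b + weight c

sum-blockWeight : ∀ {m} (c : Vec (Bool × Bool) m) → sum (map (blockWeight ∘ vlookup c) (allFin m)) ≡ weight c
sum-blockWeight []      = refl
sum-blockWeight (b ∷ c) = cong (blockWeight b +_) (begin
  sum (map (blockWeight ∘ vlookup (b ∷ c)) (tabulateˡ suc)) ≡⟨ cong sum (map-tabulate suc (blockWeight ∘ vlookup (b ∷ c))) ⟩
  sum (tabulateˡ (blockWeight ∘ vlookup c))                ≡⟨ cong sum (map-tabulate id (blockWeight ∘ vlookup c)) ⟨
  sum (map (blockWeight ∘ vlookup c) (allFin _))           ≡⟨ sum-blockWeight c ⟩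
  weight c                                                 ∎)
  where open ≡-Reasoning

blockStates : List (Bool × Bool)
blockStates = (true , true) ∷ (false , true) ∷ (true , false) ∷ (false , false) ∷ []

∈blockStates : ∀ b → b ∈ˡ blockStates
∈blockStates (true  , true)  = here refl
∈blockStates (false , true)  = there (here refl)
∈blockStates (true  , false) = there (there (here refl))
∈blockStates (false , false) = there (there (there (here refl)))

blockStates-unique : Unique blockStates
blockStates-unique = ((λ ()) ∷ (λ ()) ∷ (λ ()) ∷ []) ∷ ((λ ()) ∷ (λ ()) ∷ []) ∷ ((λ ()) ∷ []) ∷ [] ∷ []

allConfigs : ∀ m → List (Vec (Bool × Bool) m)
allConfigs zero    = [] ∷ []
allConfigs (suc m) = cartesianProductWith _∷_ blockStates (allConfigs m)

allConfigs-complete : ∀ m (c : Vec (Bool × Bool) m) → c ∈ˡ allConfigs m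
allConfigs-complete zero    []      = here refl
allConfigs-complete (suc m) (b ∷ c) = ∈-cartesianProductWith⁺ _∷_ (∈blockStates b) (allConfigs-complete m c)

allConfigs-unique : ∀ m → Unique (allConfigs m)
allConfigs-unique zero    = [] ∷ []
allConfigs-unique (suc m) = cartesianProductWith⁺ _∷_ ∷-injective blockStates-unique (allConfigs-unique m)

blockTypes-sum : ∀ x t → x ^ 3 * t + (x ^ 2 * t + (x ^ 2 * t + (x ^ 2 * t + 0))) ≡ (x ^ 3 + 3 * x ^ 2) * t
blockTypes-sum = solve 2 (λ x t → x :^ 3 :* t :+ (x :^ 2 :* t :+ (x :^ 2 :* t :+ (x :^ 2 :* t :+ con 0))) :=
                           (x :^ 3 :+ con 3 :* x :^ 2) :* t) refl
  where open +-*-Solver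

sum-allConfigs-weight : ∀ x m → sum (map (λ c → x ^ weight c) (allConfigs m)) ≡ (x ^ 3 + 3 * x ^ 2) ^ m
sum-allConfigs-weight x zero    = refl
sum-allConfigs-weight x (suc m) = begin
  sum (map (λ c → x ^ weight c) (cartesianProductWith _∷_ blockStates (allConfigs m)))
    ≡⟨ sum-cartesianProductWith (λ c → x ^ weight c) _∷_ blockStates (allConfigs m) ⟩
  sum (map (λ b → sum (map (λ c → x ^ (blockWeight b + weight c)) (allConfigs m))) blockStates)
    ≡⟨ cong sum (map-cong factor blockStates) ⟩
  sum (map (λ b → x ^ blockWeight b * T) blockStates)
    ≡⟨ blockTypes-sum x T ⟩
  (x ^ 3 + 3 * x ^ 2) * T
    ≡⟨ cong ((x ^ 3 + 3 * x ^ 2) *_) (sum-allConfigs-weight x m) ⟩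
  (x ^ 3 + 3 * x ^ 2) ^ suc m ∎
  where
  open ≡-Reasoning
  T = sum (map (λ c → x ^ weight c) (allConfigs m))
  factor : ∀ b → sum (map (λ c → x ^ (blockWeight b + weight c)) (allConfigs m)) ≡ x ^ blockWeight b * T
  factor b = trans (cong sum (map-cong (λ c → ^-distribˡ-+-* x (blockWeight b) (weight c)) (allConfigs m)))
                   (sum-map-*ˡ (x ^ blockWeight b) (λ c → x ^ weight c) (allConfigs m))

-- Perfect matchings of H_n, block by block

inBlock-injective : ∀ {n} {j j' : Fin n} {i i'} → inBlock j (localEdge i) ≡ inBlock j' (localEdge i') → j ≡ j' × i ≡ i'
inBlock-injective {i = i} {i'} eq =
  cong blockOf eq , localEdge-injective i i' (cong (λ p → proj₂ (proj₁ p) , proj₂ (proj₂ p)) eq)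

Touches : ∀ {n} → VH n → VH n × VH n → Set
Touches v p = proj₁ p ≡ v ⊎ proj₂ p ≡ v

bridgesAt : ∀ {n} → Fin n → Site → List (VH n × VH n)
bridgesAt j (zero     , suc zero)       = fromMaybe (Maybe.map (λ k → crossV k j) (prevBlock j))
bridgesAt j (zero     , suc (suc zero)) = fromMaybe (Maybe.map (λ k → crossU k j) (prevBlock j))
bridgesAt j (suc zero , suc zero)       = fromMaybe (Maybe.map (crossV j) (nextBlock j))
bridgesAt j (suc zero , suc (suc zero)) = fromMaybe (Maybe.map (crossU j) (nextBlock j))
bridgesAt j _                           = []

starAt : ∀ {n} → Fin n → Site → List (VH n × VH n)
starAt j x = map (inBlock j ∘ localEdge) (localStar x) ++ bridgesAt j x

starAt-complete : ∀ {n} (j : Fin n) x {p} → p ∈ˡ edgesH n → Touches (j , x) p → p ∈ˡ starAt j x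
starAt-complete j x p∈ touches with edgesH-classify p∈
... | inj₁ (_ , i , refl) with touches
...   | inj₁ refl = ∈-++⁺ˡ (∈-map⁺ (inBlock j ∘ localEdge) (localStar-complete i x (inj₁ refl)))
...   | inj₂ refl = ∈-++⁺ˡ (∈-map⁺ (inBlock j ∘ localEdge) (localStar-complete i x (inj₂ refl)))
starAt-complete j x p∈ touches | inj₂ (_ , _ , next , inj₁ refl) with touches
...   | inj₁ refl rewrite IsNext⇒nextBlock next = ∈-++⁺ʳ (map (inBlock j ∘ localEdge) (localStar (s1 , ru))) (here refl)
...   | inj₂ refl rewrite IsNext⇒prevBlock next = ∈-++⁺ʳ (map (inBlock j ∘ localEdge) (localStar (s0 , ru))) (here refl)
starAt-complete j x p∈ touches | inj₂ (_ , _ , next , inj₂ refl) with touches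
...   | inj₁ refl rewrite IsNext⇒nextBlock next = ∈-++⁺ʳ (map (inBlock j ∘ localEdge) (localStar (s1 , rv))) (here refl)
...   | inj₂ refl rewrite IsNext⇒prevBlock next = ∈-++⁺ʳ (map (inBlock j ∘ localEdge) (localStar (s0 , rv))) (here refl)

bridgesAt-sound : ∀ {n} (j : Fin n) x {p} → p ∈ˡ bridgesAt j x → Touches (j , x) p × blockOf p ≢ proj₁ (proj₂ p)
bridgesAt-sound j (zero , suc zero) p∈ with ∈-fromMaybe-map⁻ _ (prevBlock j) p∈
... | _ , prev≡ , refl = inj₂ refl , IsNext⇒≢ (prevBlock⇒IsNext prev≡)
bridgesAt-sound j (zero , suc (suc zero)) p∈ with ∈-fromMaybe-map⁻ _ (prevBlock j) p∈
... | _ , prev≡ , refl = inj₂ refl , IsNext⇒≢ (prevBlock⇒IsNext prev≡)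
bridgesAt-sound j (suc zero , suc zero) p∈ with ∈-fromMaybe-map⁻ _ (nextBlock j) p∈
... | _ , next≡ , refl = inj₁ refl , IsNext⇒≢ (nextBlock⇒IsNext next≡)
bridgesAt-sound j (suc zero , suc (suc zero)) p∈ with ∈-fromMaybe-map⁻ _ (nextBlock j) p∈
... | _ , next≡ , refl = inj₁ refl , IsNext⇒≢ (nextBlock⇒IsNext next≡)

starAt-sound : ∀ {n} (j : Fin n) x {p} → p ∈ˡ starAt j x → Touches (j , x) p
starAt-sound j x p∈ with ∈-++⁻ (map (inBlock j ∘ localEdge) (localStar x)) p∈
... | inj₂ p∈ᵇ = proj₁ (bridgesAt-sound j x p∈ᵇ)
... | inj₁ p∈ˡ with ∈-map⁻ (inBlock j ∘ localEdge) p∈ˡ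
...   | i , i∈ , refl with localStar-sound x i i∈
...     | inj₁ fst≡ = inj₁ (cong (j ,_) fst≡)
...     | inj₂ snd≡ = inj₂ (cong (j ,_) snd≡)

bridgesAt-unique : ∀ {n} (j : Fin n) x → Unique (bridgesAt j x)
bridgesAt-unique j (zero     , zero)                 = []
bridgesAt-unique j (zero     , suc zero)             = fromMaybe-unique (Maybe.map _ (prevBlock j))
bridgesAt-unique j (zero     , suc (suc zero))       = fromMaybe-unique (Maybe.map _ (prevBlock j))
bridgesAt-unique j (zero     , suc (suc (suc zero))) = []
bridgesAt-unique j (suc zero , zero)                 = []
bridgesAt-unique j (suc zero , suc zero)             = fromMaybe-unique (Maybe.map _ (nextBlock j))
bridgesAt-unique j (suc zero , suc (suc zero))       = fromMaybe-unique (Maybe.map _ (nextBlock j))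
bridgesAt-unique j (suc zero , suc (suc (suc zero))) = []

starAt-unique : ∀ {n} (j : Fin n) x → Unique (starAt j x)
starAt-unique j x = ++⁺ (map⁺ (proj₂ ∘ inBlock-injective) (localStar-unique x)) (bridgesAt-unique j x) disjoint
  where
  disjoint : ∀ {p} → ¬ (p ∈ˡ map (inBlock j ∘ localEdge) (localStar x) × p ∈ˡ bridgesAt j x)
  disjoint (p∈ˡ , p∈ᵇ) with ∈-map⁻ (inBlock j ∘ localEdge) p∈ˡ
  ... | _ , _ , refl = proj₂ (bridgesAt-sound j x p∈ᵇ) refl

module BlockView (n : ℕ) where
  open H n public
  open GraphTheoryProperties (_≟VH_ {n}) (∀VH? {n}) (edgesH n) public

  ends-injective : ∀ {e e' : Edge} → ends e ≡ ends e' → e ≡ e'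
  ends-injective = Unique⇒lookup-injective (edgesH n) (edgesH-unique n) _ _

  ends∈edgesH : ∀ (e : Edge) → ends e ∈ˡ edgesH n
  ends∈edgesH e = ∈-lookup e

  edgeAt : ∀ {p} → p ∈ˡ edgesH n → Edge
  edgeAt = index

  ends-edgeAt : ∀ {p} (p∈ : p ∈ˡ edgesH n) → ends (edgeAt p∈) ≡ p
  ends-edgeAt p∈ = sym (lookup-index p∈)

  HasEdge : EdgeSet → VH n × VH n → Set
  HasEdge N p = ∃ λ e → e ∈ N × ends e ≡ p

  hasEdge? : ∀ N p → Dec (HasEdge N p)
  hasEdge? N p = any? λ e → (e ∈? N) ×-dec (≡-dec _≟VH_ _≟VH_ (ends e) p)

  uses : EdgeSet → VH n × VH n → Bool
  uses N p = does (hasEdge? N p)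

  uses≡true⇒ : ∀ {N p} → uses N p ≡ true → HasEdge N p
  uses≡true⇒ {N} {p} = does≡true⇒ (hasEdge? N p)

  localPattern : EdgeSet → Fin n → Vec Bool 10
  localPattern N j = tabulate (λ i → uses N (inBlock j (localEdge i)))

  localPattern-lookup : ∀ N j i → vlookup (localPattern N j) i ≡ uses N (inBlock j (localEdge i))
  localPattern-lookup N j i = lookup∘tabulate (uses N ∘ inBlock j ∘ localEdge) i

  rightU rightV leftU leftV : EdgeSet → Fin n → Bool
  rightU N j = maybe′ (λ k → uses N (crossU j k)) false (nextBlock j)
  rightV N j = maybe′ (λ k → uses N (crossV j k)) false (nextBlock j)
  leftU  N j = maybe′ (λ k → uses N (crossU k j)) false (prevBlock j)
  leftV  N j = maybe′ (λ k → uses N (crossV k j)) false (prevBlock j)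

  BlockPerfect : EdgeSet → Fin n → Set
  BlockPerfect N j = LocallyPerfect (localPattern N j) (rightU N j) (rightV N j) (leftU N j) (leftV N j)

  countTrue-bridgesAt : ∀ N j x → countTrue (map (uses N) (bridgesAt j x)) ≡
                        countTrue (bridgeFlags x (rightU N j) (rightV N j) (leftU N j) (leftV N j))
  countTrue-bridgesAt N j (zero     , zero)                 = refl
  countTrue-bridgesAt N j (zero     , suc zero)             = countTrue-fromMaybe (uses N) _ (prevBlock j)
  countTrue-bridgesAt N j (zero     , suc (suc zero))       = countTrue-fromMaybe (uses N) _ (prevBlock j)
  countTrue-bridgesAt N j (zero     , suc (suc (suc zero))) = refl
  countTrue-bridgesAt N j (suc zero , zero)                 = refl
  countTrue-bridgesAt N j (suc zero , suc zero)             = countTrue-fromMaybe (uses N) _ (nextBlock j)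
  countTrue-bridgesAt N j (suc zero , suc (suc zero))       = countTrue-fromMaybe (uses N) _ (nextBlock j)
  countTrue-bridgesAt N j (suc zero , suc (suc (suc zero))) = refl

  countTrue-starAt : ∀ N j x → length (filter (hasEdge? N) (starAt j x)) ≡
    countTrue (map (vlookup (localPattern N j)) (localStar x) ++ bridgeFlags x (rightU N j) (rightV N j) (leftU N j) (leftV N j))
  countTrue-starAt N j x = begin
    length (filter (hasEdge? N) (starAt j x))
      ≡⟨ sym (countTrue-does (hasEdge? N) (starAt j x)) ⟩
    countTrue (map (uses N) (starAt j x))
      ≡⟨ cong countTrue (map-++ (uses N) (map (inBlock j ∘ localEdge) (localStar x)) (bridgesAt j x)) ⟩
    countTrue (map (uses N) (map (inBlock j ∘ localEdge) (localStar x)) ++ map (uses N) (bridgesAt j x))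
      ≡⟨ countTrue-++ (map (uses N) (map (inBlock j ∘ localEdge) (localStar x))) _ ⟩
    countTrue (map (uses N) (map (inBlock j ∘ localEdge) (localStar x))) + countTrue (map (uses N) (bridgesAt j x))
      ≡⟨ cong₂ _+_ (cong countTrue localPart) (countTrue-bridgesAt N j x) ⟩
    countTrue (map (vlookup (localPattern N j)) (localStar x)) + countTrue (bridgeFlags x _ _ _ _)
      ≡⟨ sym (countTrue-++ (map (vlookup (localPattern N j)) (localStar x)) _) ⟩
    countTrue (map (vlookup (localPattern N j)) (localStar x) ++ bridgeFlags x _ _ _ _) ∎
    where
    open ≡-Reasoning
    localPart : map (uses N) (map (inBlock j ∘ localEdge) (localStar x)) ≡ map (vlookup (localPattern N j)) (localStar x)
    localPart = trans (sym (map-∘ (localStar x))) (map-cong (sym ∘ localPattern-lookup N j) (localStar x))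

  perfectMatching⇒BlockPerfect : ∀ {F N} → IsPerfectMatching F N → ∀ j → BlockPerfect N j
  perfectMatching⇒BlockPerfect {F} {N} pm j x = trans (sym (countTrue-starAt N j x))
    (length-filter≡1 (hasEdge? N) (starAt j x) (starAt-unique j x) (starAt-complete j x (ends∈edgesH e) inc) (e , e∈N , refl)
      λ { p∈ (e' , e'∈N , refl) → cong ends (unique e'∈N (starAt-sound j x p∈) e∈N inc) })
    where
    covered = isPerfectMatching⁻ pm (j , x)
    e = proj₁ (proj₁ covered)
    e∈N = proj₁ (proj₂ (proj₁ covered))
    inc = proj₂ (proj₂ (proj₁ covered))
    unique = proj₂ covered

  BlockPerfect⇒perfectMatching : ∀ {F N} → N ⊆ F → (∀ j → BlockPerfect N j) → IsPerfectMatching F N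
  BlockPerfect⇒perfectMatching {F} {N} N⊆F perfect = isPerfectMatching⁺ N⊆F λ (j , x) →
    let len≡1 = trans (countTrue-starAt N j x) (perfect j x)
        (p , p∈) = length≡1⇒nonempty (filter (hasEdge? N) (starAt j x)) len≡1
        (p∈star , e , e∈N , ends≡) = ∈-filter⁻ (hasEdge? N) {xs = starAt j x} p∈
    in (e , e∈N , subst (Touches (j , x)) (sym ends≡) (starAt-sound j x p∈star)) ,
       λ {e₁} {e₂} e₁∈N inc₁ e₂∈N inc₂ → ends-injective
         (length-filter≡1⇒unique (hasEdge? N) (starAt j x) len≡1
           (starAt-complete j x (ends∈edgesH e₁) inc₁) (starAt-complete j x (ends∈edgesH e₂) inc₂)
           (e₁ , e₁∈N , refl) (e₂ , e₂∈N , refl))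

  Patterned : (Fin n → Vec Bool 10) → VH n × VH n → Set
  Patterned h p = ∃ λ j → ∃ λ i → p ≡ inBlock j (localEdge i) × vlookup (h j) i ≡ true

  patterned? : ∀ h p → Dec (Patterned h p)
  patterned? h p = any? λ j → any? λ i → ≡-dec _≟VH_ _≟VH_ p (inBlock j (localEdge i)) ×-dec (vlookup (h j) i ≟ᴮ true)

  blockwise : (Fin n → Vec Bool 10) → EdgeSet
  blockwise h = tabulate (does ∘ patterned? h ∘ ends)

  ∈blockwise⁻ : ∀ h {e} → e ∈ blockwise h → Patterned h (ends e)
  ∈blockwise⁻ h {e} e∈ = does≡true⇒ (patterned? h (ends e)) (∈-tabulate⁻ (does ∘ patterned? h ∘ ends) e∈)

  ∈blockwise⁺ : ∀ h {e} → Patterned h (ends e) → e ∈ blockwise h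
  ∈blockwise⁺ h {e} pat = ∈-tabulate⁺ (does ∘ patterned? h ∘ ends) (dec-true (patterned? h (ends e)) pat)

  Patterned-inBlock : ∀ h {j i} → Patterned h (inBlock j (localEdge i)) → vlookup (h j) i ≡ true
  Patterned-inBlock h {j} {i} (j' , i' , ends≡ , hi) with inBlock-injective {j = j} {j'} {i} {i'} ends≡
  ... | refl , refl = hi

  uses-blockwise-inBlock : ∀ h j i → uses (blockwise h) (inBlock j (localEdge i)) ≡ vlookup (h j) i
  uses-blockwise-inBlock h j i = Bool-≡ (vlookup (h j) i) used unused
    where
    p∈ = inBlock∈edgesH j i
    used : vlookup (h j) i ≡ true → uses (blockwise h) (inBlock j (localEdge i)) ≡ true
    used hji = dec-true (hasEdge? (blockwise h) (inBlock j (localEdge i)))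
      (edgeAt p∈ , ∈blockwise⁺ h (subst (Patterned h) (sym (ends-edgeAt p∈)) (j , i , refl , hji)) , ends-edgeAt p∈)
    unused : vlookup (h j) i ≡ false → uses (blockwise h) (inBlock j (localEdge i)) ≡ false
    unused hji = dec-false (hasEdge? (blockwise h) (inBlock j (localEdge i))) λ (e , e∈ , ends≡) →
      true≢false (trans (sym (Patterned-inBlock h (subst (Patterned h) ends≡ (∈blockwise⁻ h e∈)))) hji)

  localPattern-blockwise : ∀ h j → localPattern (blockwise h) j ≡ h j
  localPattern-blockwise h j = trans (tabulate-cong (uses-blockwise-inBlock h j)) (tabulate∘lookup (h j))

  blockwise-noBridge : ∀ h {p} → blockOf p ≢ proj₁ (proj₂ p) → uses (blockwise h) p ≡ false
  blockwise-noBridge h {p} bridge = dec-false (hasEdge? (blockwise h) p) λ (e , e∈ , ends≡p) →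
    let (_ , _ , ends≡ , _) = ∈blockwise⁻ h e∈
        ends≡′ = trans (sym ends≡p) ends≡
    in bridge (trans (cong (proj₁ ∘ proj₁) ends≡′) (sym (cong (proj₁ ∘ proj₂) ends≡′)))

  blockwise-noBridges : ∀ h j → rightU (blockwise h) j ≡ false × rightV (blockwise h) j ≡ false ×
                                leftU (blockwise h) j ≡ false × leftV (blockwise h) j ≡ false
  blockwise-noBridges h j =
    noBridgeAt (nextBlock j) (λ next≡ → blockwise-noBridge h (IsNext⇒≢ (nextBlock⇒IsNext next≡))) ,
    noBridgeAt (nextBlock j) (λ next≡ → blockwise-noBridge h (IsNext⇒≢ (nextBlock⇒IsNext next≡))) ,
    noBridgeAt (prevBlock j) (λ prev≡ → blockwise-noBridge h (IsNext⇒≢ (prevBlock⇒IsNext prev≡))) ,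
    noBridgeAt (prevBlock j) (λ prev≡ → blockwise-noBridge h (IsNext⇒≢ (prevBlock⇒IsNext prev≡)))
    where
    noBridgeAt : ∀ {f : Fin n → Bool} m → (∀ {k} → m ≡ just k → f k ≡ false) → maybe′ f false m ≡ false
    noBridgeAt nothing  _     = refl
    noBridgeAt (just k) f≡false = f≡false refl

  blockwise-perfectMatching : ∀ {F} (t : Fin n → BlockType) → blockwise (blockMatching ∘ t) ⊆ F →
                              IsPerfectMatching F (blockwise (blockMatching ∘ t))
  blockwise-perfectMatching {F} t M⊆F = BlockPerfect⇒perfectMatching {F} {M} M⊆F perfect
    where
    M : EdgeSet
    M = blockwise (blockMatching ∘ t)
    perfect : ∀ j → BlockPerfect M j
    perfect j = LocallyPerfect-cong (sym (localPattern-blockwise (blockMatching ∘ t) j))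
      (sym rU≡) (sym rV≡) (sym lU≡) (sym lV≡) (blockMatching-locallyPerfect (t j))
      where
      noBridges = blockwise-noBridges (blockMatching ∘ t) j
      rU≡ = proj₁ noBridges
      rV≡ = proj₁ (proj₂ noBridges)
      lU≡ = proj₁ (proj₂ (proj₂ noBridges))
      lV≡ = proj₂ (proj₂ (proj₂ noBridges))

  rightU-IsNext : ∀ N {j k} → IsNext j k → rightU N j ≡ uses N (crossU j k)
  rightU-IsNext N {j} next = cong (maybe′ (λ k → uses N (crossU j k)) false) (IsNext⇒nextBlock next)

  rightV-IsNext : ∀ N {j k} → IsNext j k → rightV N j ≡ uses N (crossV j k)
  rightV-IsNext N {j} next = cong (maybe′ (λ k → uses N (crossV j k)) false) (IsNext⇒nextBlock next)

  LeftFree RightFree : EdgeSet → Fin n → Set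
  LeftFree  N j = leftU  N j ≡ false × leftV  N j ≡ false
  RightFree N j = rightU N j ≡ false × rightV N j ≡ false

  -- The left bridges of block k+1 are the right bridges of block k.
  leftFree-all : ∀ N → (∀ j → LeftFree N j → RightFree N j) → ∀ j → LeftFree N j
  leftFree-all N propagate j = go (toℕ j) j refl
    where
    go : ∀ m j → toℕ j ≡ m → LeftFree N j
    go zero    zero    _     = refl , refl
    go (suc m) (suc k) toℕ≡ =
      trans (sym (rightU-IsNext N {inject₁ k} {suc k} next)) (proj₁ rightFree) ,
      trans (sym (rightV-IsNext N {inject₁ k} {suc k} next)) (proj₂ rightFree)
      where
      next : IsNext (inject₁ k) (suc k)
      next = cong suc (sym (toℕ-inject₁ k))
      rightFree : RightFree N (inject₁ k)
      rightFree = propagate (inject₁ k) (go m (inject₁ k) (trans (toℕ-inject₁ k) (suc-injective toℕ≡)))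

  ≡blockwise : ∀ N h → (∀ j → localPattern N j ≡ h j) → (∀ j → RightFree N j) → N ≡ blockwise h
  ≡blockwise N h pattern≡ free = ⊆-antisym N⊆ ⊆N
    where
    uses≡ : ∀ j i → uses N (inBlock j (localEdge i)) ≡ vlookup (h j) i
    uses≡ j i = trans (sym (localPattern-lookup N j i)) (cong (λ β → vlookup β i) (pattern≡ j))
    N⊆ : N ⊆ blockwise h
    N⊆ {e} e∈N = byKind (edgesH-classify (ends∈edgesH e))
      where
      byKind : IsBlockEdge (ends e) ⊎ IsBridgeEdge (ends e) → e ∈ blockwise h
      byKind (inj₁ (j , i , ends≡)) =
        ∈blockwise⁺ h (j , i , ends≡ , trans (sym (uses≡ j i)) (dec-true (hasEdge? N (inBlock j (localEdge i))) (e , e∈N , ends≡)))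
      byKind (inj₂ (j , k , next , inj₁ ends≡)) = contradiction
        (trans (sym (dec-true (hasEdge? N (crossU j k)) (e , e∈N , ends≡))) (trans (sym (rightU-IsNext N next)) (proj₁ (free j))))
        true≢false
      byKind (inj₂ (j , k , next , inj₂ ends≡)) = contradiction
        (trans (sym (dec-true (hasEdge? N (crossV j k)) (e , e∈N , ends≡))) (trans (sym (rightV-IsNext N next)) (proj₂ (free j))))
        true≢false
    ⊆N : blockwise h ⊆ N
    ⊆N {e} e∈ =
      let (j , i , ends≡ , hji) = ∈blockwise⁻ h e∈
          (e' , e'∈N , ends'≡) = uses≡true⇒ {N} {inBlock j (localEdge i)} (trans (uses≡ j i) hji)
      in subst (_∈ N) (ends-injective (trans ends'≡ (sym ends≡))) e'∈N

  blockwise-determined : ∀ N h → (∀ j → LeftFree N j → RightFree N j × localPattern N j ≡ h j) → N ≡ blockwise h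
  blockwise-determined N h local = ≡blockwise N h (λ j → proj₂ (local j (leftFree j))) (λ j → proj₁ (local j (leftFree j)))
    where
    leftFree = leftFree-all N (λ j → proj₁ ∘ local j)

-- Configurations and their anti-forcing numbers

module Configurations (n : ℕ) where
  open BlockView n public

  Config : Set
  Config = Vec (Bool × Bool) n

  matchingPattern antiForcingPattern : Config → Fin n → Vec Bool 10
  matchingPattern    c = blockMatching ∘ blockType ∘ vlookup c
  antiForcingPattern c = blockAntiForcing ∘ blockType ∘ vlookup c

  matchingOf antiForcingOf : Config → EdgeSet
  matchingOf    c = blockwise (matchingPattern c)
  antiForcingOf c = blockwise (antiForcingPattern c)

  configOf : EdgeSet → Config
  configOf N = tabulate λ j → vlookup (localPattern N j) w₀w₁ , vlookup (localPattern N j) z₀z₁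

  unused-inBlock : ∀ N j i → ¬ HasEdge N (inBlock j (localEdge i)) → vlookup (localPattern N j) i ≡ false
  unused-inBlock N j i ¬has = trans (localPattern-lookup N j i) (dec-false (hasEdge? N (inBlock j (localEdge i))) ¬has)

  𝓜₀⇒≡matchingOf : ∀ N → Is𝓜₀ n N → N ≡ matchingOf (configOf N)
  𝓜₀⇒≡matchingOf N (pm , no-uv) = blockwise-determined N (matchingPattern (configOf N)) local
    where
    uv-unused : ∀ j s i → localEdge i ≡ ((s , ru) , (s , rv)) → vlookup (localPattern N j) i ≡ false
    uv-unused j s i uv = unused-inBlock N j i λ (e , e∈N , ends≡) → no-uv e j s (trans ends≡ (cong (inBlock j) uv)) e∈N
    local : ∀ j → LeftFree N j → RightFree N j × localPattern N j ≡ matchingPattern (configOf N) j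
    local j (lU≡ , lV≡) =
      let (rU≡ , rV≡ , pattern≡) = locallyPerfect-without-uv⇒blockMatching (localPattern N j) (rightU N j) (rightV N j)
            (LocallyPerfect-leftFree {localPattern N j} {rightU N j} {rightV N j} lU≡ lV≡ (perfectMatching⇒BlockPerfect {allEdges} {N} pm j))
            (uv-unused j s0 u₀v₀ refl) (uv-unused j s1 u₁v₁ refl)
      in (rU≡ , rV≡) , trans pattern≡ (cong (blockMatching ∘ blockType) (sym (lookup∘tabulate _ j)))

  perfectMatching-avoiding-antiForcingOf : ∀ c N → IsPerfectMatching (∁ (antiForcingOf c)) N → N ≡ matchingOf c
  perfectMatching-avoiding-antiForcingOf c N pm = blockwise-determined N (matchingPattern c) local
    where
    avoids : ∀ j → Avoids (localPattern N j) (antiForcingPattern c j)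
    avoids j i σi = unused-inBlock N j i λ (e , e∈N , ends≡) →
      x∈∁p⇒x∉p (proj₁ pm e∈N) (∈blockwise⁺ (antiForcingPattern c) (j , i , ends≡ , σi))
    local : ∀ j → LeftFree N j → RightFree N j × localPattern N j ≡ matchingPattern c j
    local j (lU≡ , lV≡) =
      let (rU≡ , rV≡ , pattern≡) = locallyPerfect-avoiding⇒blockMatching (vlookup c j) (localPattern N j) (rightU N j) (rightV N j)
            (LocallyPerfect-leftFree {localPattern N j} {rightU N j} {rightV N j} lU≡ lV≡ (perfectMatching⇒BlockPerfect {∁ (antiForcingOf c)} {N} pm j)) (avoids j)
      in (rU≡ , rV≡) , pattern≡

  antiForcingOf-disjoint : ∀ c {e} → e ∈ antiForcingOf c → e ∉ matchingOf c
  antiForcingOf-disjoint c {e} e∈S e∈M =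
    let (j , i , ends≡ , σi) = ∈blockwise⁻ (antiForcingPattern c) e∈S
        μi = Patterned-inBlock (matchingPattern c) {j} {i} (subst (Patterned (matchingPattern c)) ends≡ (∈blockwise⁻ (matchingPattern c) e∈M))
    in true≢false (trans (sym μi) (blockAntiForcing-avoids-blockMatching (vlookup c j) i σi))

  matchingOf-perfectMatching : ∀ {F} c → matchingOf c ⊆ F → IsPerfectMatching F (matchingOf c)
  matchingOf-perfectMatching c = blockwise-perfectMatching (blockType ∘ vlookup c)

  antiForcingOf-isAntiForcingSet : ∀ c → IsAntiForcingSet (matchingOf c) (antiForcingOf c)
  antiForcingOf-isAntiForcingSet c =
    x∉p⇒x∈∁p ∘ antiForcingOf-disjoint c ,
    unique-perfectMatching (∁ (antiForcingOf c)) (matchingOf c)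
      (matchingOf-perfectMatching c (λ e∈M → x∉p⇒x∈∁p (λ e∈S → antiForcingOf-disjoint c e∈S e∈M)))
      (perfectMatching-avoiding-antiForcingOf c)

  antiForcingListAt : Config → Fin n → List Edge
  antiForcingListAt c j = map (edgeAt ∘ inBlock∈edgesH j) (blockAntiForcingEdges (blockType (vlookup c j)))

  antiForcingList : Config → List Edge
  antiForcingList c = concatMap (antiForcingListAt c) (allFin n)

  ∣antiForcingOf∣≤weight : ∀ c → ∣ antiForcingOf c ∣ ≤ weight c
  ∣antiForcingOf∣≤weight c = ≤-trans (∣p∣≤length (antiForcingOf c) (antiForcingList c) ⊆list) (≤-reflexive length≡)
    where
    ⊆list : ∀ {e} → e ∈ antiForcingOf c → e ∈ˡ antiForcingList c
    ⊆list {e} e∈S =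
      let (j , i , ends≡ , σi) = ∈blockwise⁻ (antiForcingPattern c) e∈S
          p∈ = inBlock∈edgesH j i
      in subst (_∈ˡ antiForcingList c) (ends-injective (trans (ends-edgeAt p∈) (sym ends≡)))
           (∈-concatMap⁺ (antiForcingListAt c) (lose (∈-allFin j) (∈-map⁺ (edgeAt ∘ inBlock∈edgesH j) (∈-indicator⁻ (blockAntiForcingEdges (blockType (vlookup c j))) {i} σi))))
    length≡ : length (antiForcingList c) ≡ weight c
    length≡ = begin
      length (antiForcingList c)
        ≡⟨ length-concatMap (antiForcingListAt c) (allFin n) ⟩
      sum (map (length ∘ antiForcingListAt c) (allFin n))
        ≡⟨ cong sum (map-cong (λ j → trans (length-map (edgeAt ∘ inBlock∈edgesH j) (blockAntiForcingEdges (blockType (vlookup c j)))) (length-blockAntiForcingEdges (vlookup c j))) (allFin n)) ⟩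
      sum (map (blockWeight ∘ vlookup c) (allFin n))
        ≡⟨ sum-blockWeight c ⟩
      weight c ∎
      where open ≡-Reasoning

  alternativeList : Config → List (Fin n × BlockType)
  alternativeList c = concatMap (λ j → map (j ,_) (alternatives (blockType (vlookup c j)))) (allFin n)

  length-alternativeList : ∀ c → length (alternativeList c) ≡ weight c
  length-alternativeList c = trans (length-concatMap _ (allFin n))
    (trans (cong sum (map-cong (λ j → length-map (j ,_) (alternatives (blockType (vlookup c j)))) (allFin n))) (sum-blockWeight c))

  ∈alternativeList⁻ : ∀ c {j t} → (j , t) ∈ˡ alternativeList c → t ∈ˡ alternatives (blockType (vlookup c j))
  ∈alternativeList⁻ c jt∈ with find (∈-concatMap⁻ _ {xs = allFin n} jt∈)
  ... | j , _ , jt∈ⱼ with ∈-map⁻ (j ,_) jt∈ⱼ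
  ...   | t , t∈ , refl = t∈

  alternativeList-unique : ∀ c → Unique (alternativeList c)
  alternativeList-unique c = concatMap-unique _ proj₁ (allFin n) (allFin⁺ n)
    (λ j → map⁺ (λ { refl → refl }) (alternatives-unique (vlookup c j)))
    (λ j jt∈ → let (_ , _ , jt≡) = ∈-map⁻ (j ,_) jt∈ in cong proj₁ jt≡)

  switched : Config → Fin n → BlockType → Fin n → BlockType
  switched c j t j' = if does (j' ≟F j) then t else blockType (vlookup c j')

  switched-here : ∀ c j t → switched c j t j ≡ t
  switched-here c j t = cong (if_then t else blockType (vlookup c j)) (dec-true (j ≟F j) refl)

  switchedMatching : Config → Fin n → BlockType → EdgeSet
  switchedMatching c j t = blockwise (blockMatching ∘ switched c j t)

  NewEdge : EdgeSet → Config → Fin n × BlockType → Edge → Set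
  NewEdge S c (j , t) e = e ∈ S × e ∈ switchedMatching c j t × e ∉ matchingOf c

  newEdge? : ∀ S c jt → Dec (∃ (NewEdge S c jt))
  newEdge? S c (j , t) = any? λ e → (e ∈? S) ×-dec ((e ∈? switchedMatching c j t) ×-dec ¬? (e ∈? matchingOf c))

  -- Switching block j to an alternative t is another perfect matching of H_n, so S must break it.
  antiForcing-meets-alternative : ∀ S c j t → IsAntiForcingSet (matchingOf c) S →
                                  t ∈ˡ alternatives (blockType (vlookup c j)) → ¬ ¬ ∃ (NewEdge S c (j , t))
  antiForcing-meets-alternative S c j t (S⊆∁M , unique) t∈ ¬new = true≢false (trans (sym old) (proj₂ (proj₂ newEdge)))
    where
    M' = switchedMatching c j t
    M'⊆∁S : M' ⊆ ∁ S
    M'⊆∁S {e} e∈M' = x∉p⇒x∈∁p λ e∈S → case e ∈? matchingOf c of λ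
      { (yes e∈M) → x∈∁p⇒x∉p (S⊆∁M e∈S) e∈M
      ; (no  e∉M) → ¬new (e , e∈S , e∈M' , e∉M) }
    M≡M' : matchingOf c ≡ M'
    M≡M' = perfectMatching-unique (∁ S) unique
      (matchingOf-perfectMatching c (λ e∈M → x∉p⇒x∈∁p (λ e∈S → x∈∁p⇒x∉p (S⊆∁M e∈S) e∈M)))
      (blockwise-perfectMatching (switched c j t) M'⊆∁S)
    newEdge = alternative-hasNewEdge (vlookup c j) t t∈
    i = proj₁ newEdge
    p∈ = inBlock∈edgesH j i
    new∈M' : edgeAt p∈ ∈ M'
    new∈M' = ∈blockwise⁺ (blockMatching ∘ switched c j t)
      (j , i , ends-edgeAt p∈ , subst (λ t → vlookup (blockMatching t) i ≡ true) (sym (switched-here c j t)) (proj₁ (proj₂ newEdge)))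
    new∈M : edgeAt p∈ ∈ matchingOf c
    new∈M = subst (edgeAt p∈ ∈_) (sym M≡M') new∈M'
    old : vlookup (matchingPattern c j) i ≡ true
    old = Patterned-inBlock (matchingPattern c) {j} {i}
      (subst (Patterned (matchingPattern c)) (ends-edgeAt p∈) (∈blockwise⁻ (matchingPattern c) new∈M))

  NewAt : Config → Fin n × BlockType → Edge → Set
  NewAt c (j , t) e = ∃ λ i → ends e ≡ inBlock j (localEdge i) ×
                              vlookup (blockMatching t) i ≡ true × vlookup (matchingPattern c j) i ≡ false

  NewEdge⇒NewAt : ∀ S c j t {e} → NewEdge S c (j , t) e → NewAt c (j , t) e
  NewEdge⇒NewAt S c j t {e} (_ , e∈M' , e∉M) = atBlock (∈blockwise⁻ (blockMatching ∘ switched c j t) e∈M')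
    where
    atBlock : Patterned (blockMatching ∘ switched c j t) (ends e) → NewAt c (j , t) e
    atBlock (j' , i , ends≡ , new) = byBlock (j' ≟F j) new
      where
      old : vlookup (matchingPattern c j') i ≡ false
      old = ¬-not λ oldi → e∉M (∈blockwise⁺ (matchingPattern c) (j' , i , ends≡ , oldi))
      byBlock : (same? : Dec (j' ≡ j)) →
                vlookup (blockMatching (if does same? then t else blockType (vlookup c j'))) i ≡ true → NewAt c (j , t) e
      byBlock (yes refl) new = i , ends≡ , new , old
      byBlock (no _)     new = contradiction (trans (sym new) old) true≢false

  NewAt-injective : ∀ c {j t j' t' e} → t ∈ˡ alternatives (blockType (vlookup c j)) → t' ∈ˡ alternatives (blockType (vlookup c j')) →
                    NewAt c (j , t) e → NewAt c (j' , t') e → (j , t) ≡ (j' , t')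
  NewAt-injective c {j} {t} {j'} {t'} t∈ t'∈ (i , ends≡ , new , old) (i' , ends'≡ , new' , _) =
    sameSite (inBlock-injective {j = j} {j'} {i} {i'} (trans (sym ends≡) ends'≡)) t'∈ new'
    where
    sameSite : j ≡ j' × i ≡ i' → t' ∈ˡ alternatives (blockType (vlookup c j')) → vlookup (blockMatching t') i' ≡ true →
               (j , t) ≡ (j' , t')
    sameSite (refl , refl) t'∈ new' = cong (j ,_) (alternatives-newEdge-injective (vlookup c j) t t' i t∈ t'∈ new new' old)

  pick : EdgeSet → Config → Fin n × BlockType → Edge
  pick S c (j , t) = witnessOr (edgeAt (inBlock∈edgesH j u₀v₀)) (newEdge? S c (j , t))

  pick-new : ∀ S c {j t} → IsAntiForcingSet (matchingOf c) S → (j , t) ∈ˡ alternativeList c → NewEdge S c (j , t) (pick S c (j , t))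
  pick-new S c {j} {t} afS jt∈ = witnessOr-sound (edgeAt (inBlock∈edgesH j u₀v₀)) (newEdge? S c (j , t))
    (antiForcing-meets-alternative S c j t afS (∈alternativeList⁻ c jt∈))

  pick-injective : ∀ S c → IsAntiForcingSet (matchingOf c) S → ∀ {jt jt'} → jt ∈ˡ alternativeList c → jt' ∈ˡ alternativeList c →
                   pick S c jt ≡ pick S c jt' → jt ≡ jt'
  pick-injective S c afS {j , t} {j' , t'} jt∈ jt'∈ pick≡ =
    NewAt-injective c (∈alternativeList⁻ c jt∈) (∈alternativeList⁻ c jt'∈)
      (NewEdge⇒NewAt S c j t (pick-new S c afS jt∈))
      (subst (NewAt c (j' , t')) (sym pick≡) (NewEdge⇒NewAt S c j' t' (pick-new S c afS jt'∈)))

  weight≤∣antiForcingSet∣ : ∀ c S → IsAntiForcingSet (matchingOf c) S → weight c ≤ ∣ S ∣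
  weight≤∣antiForcingSet∣ c S afS = subst (_≤ ∣ S ∣) (trans (length-map (pick S c) (alternativeList c)) (length-alternativeList c))
    (Unique⇒length≤∣p∣ (map (pick S c) (alternativeList c))
      (map-unique-injectiveOn (pick S c) (alternativeList c) (alternativeList-unique c) (pick-injective S c afS))
      λ e∈ → let (_ , jt∈ , e≡) = ∈-map⁻ (pick S c) e∈ in subst (_∈ S) (sym e≡) (proj₁ (pick-new S c afS jt∈)))

  af-matchingOf : ∀ c → af (matchingOf c) ≡ weight c
  af-matchingOf c = af≡ (matchingOf c) (weight c) (antiForcingOf c)
    (antiForcingOf-isAntiForcingSet c) (∣antiForcingOf∣≤weight c) (weight≤∣antiForcingSet∣ c)

  matchingOf-𝓜₀ : ∀ c → Is𝓜₀ n (matchingOf c)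
  matchingOf-𝓜₀ c = matchingOf-perfectMatching c (λ {e} _ → ∈allEdges e) , λ e j s ends≡ e∈M →
    let (j' , i , ends'≡ , μi) = ∈blockwise⁻ (matchingPattern c) e∈M
    in true≢false (trans (sym μi) (blockMatching-avoids-uv (vlookup c j') s i
         (cong (λ p → proj₂ (proj₁ p) , proj₂ (proj₂ p)) (trans (sym ends'≡) ends≡))))

  matchingOf-injective : ∀ {c c'} → matchingOf c ≡ matchingOf c' → c ≡ c'
  matchingOf-injective {c} {c'} M≡M' = Vec-ext λ j → blockMatching∘blockType-injective (vlookup c j) (vlookup c' j)
    (trans (sym (localPattern-blockwise (matchingPattern c) j))
      (trans (cong (λ M → localPattern M j) M≡M') (localPattern-blockwise (matchingPattern c') j)))

  𝓜₀-sameMembers-matchingOf : ∀ {M} → M ∈ˡ 𝓜₀ n → M ∈ˡ map matchingOf (allConfigs n)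
  𝓜₀-sameMembers-matchingOf {M} M∈ =
    subst (_∈ˡ map matchingOf (allConfigs n)) (sym (𝓜₀⇒≡matchingOf M (proj₂ (∈-filter⁻ (is𝓜₀? n) {xs = allSubsets nE} M∈))))
      (∈-map⁺ matchingOf (allConfigs-complete n (configOf M)))

  matchingOf-sameMembers-𝓜₀ : ∀ {M} → M ∈ˡ map matchingOf (allConfigs n) → M ∈ˡ 𝓜₀ n
  matchingOf-sameMembers-𝓜₀ M∈ =
    let (c , _ , M≡) = ∈-map⁻ matchingOf M∈
    in subst (_∈ˡ 𝓜₀ n) (sym M≡) (∈-filter⁺ (is𝓜₀? n) (allSubsets-complete nE (matchingOf c)) (matchingOf-𝓜₀ c))

  sum-𝓜₀ : ∀ (f : EdgeSet → ℕ) → sum (map f (𝓜₀ n)) ≡ sum (map (f ∘ matchingOf) (allConfigs n))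
  sum-𝓜₀ f = trans
    (sum-map-sameMembers f (filter⁺ (is𝓜₀? n) (allSubsets-unique nE))
      (map-unique-injectiveOn matchingOf (allConfigs n) (allConfigs-unique n) (λ _ _ → matchingOf-injective))
      𝓜₀-sameMembers-matchingOf matchingOf-sameMembers-𝓜₀)
    (cong sum (sym (map-∘ (allConfigs n))))

-- The identity holds for n = 0 as well.
lemma4p2 : (n : ℕ) → 1 ≤ n → (x : ℕ) →
    sum (map (λ M → x ^ H.af n M) (𝓜₀ n)) ≡ (x ^ 3 + 3 * x ^ 2) ^ n
lemma4p2 n _ x = begin
  sum (map (λ M → x ^ af M) (𝓜₀ n))                       ≡⟨ sum-𝓜₀ (λ M → x ^ af M) ⟩
  sum (map (λ c → x ^ af (matchingOf c)) (allConfigs n))   ≡⟨ cong sum (map-cong (cong (x ^_) ∘ af-matchingOf) (allConfigs n)) ⟩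
  sum (map (λ c → x ^ weight c) (allConfigs n))            ≡⟨ sum-allConfigs-weight x n ⟩
  (x ^ 3 + 3 * x ^ 2) ^ n                                  ∎
  where
  open Configurations n
  open ≡-Reasoning
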